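{- Let $\mu=(\mu_0\geq\cdots\geq\mu_\ell\geq1)$ be an integer partition with $\ell\geq1$, and $1\leq d\leq\mu_0$. Let \[ \mathbf{C}_{\mu,d}(x,t)=1+\sum_{n\geq1}\sum_{w\in\mathcal{C}_\mu(d,n)}t^{\mathrm{bigtiles}(w)}x^n. \] Then \[ \mathbf{C}_{\mu,d}(x,t)=1+\frac{x\cdot\frac{\partial}{\partial x}B_{\mu,d}(x,t)}{1-B_{\mu,d}(x,t)}. \]
   Context: For $n\geq1$, $\mathcal{C}_\mu(d,n)$ is the set of cylindric anchor words of length $n$: words $a_1\cdots a_n$ over $\{1,\dotsc,d,\infty\}$ such that for every $i$ with $a_i\neq\infty$ and every $k=1,\dotsc,\ell$, $a_{i+k}\geq a_i+\mu_k$, where indices are taken cyclically modulo $n$ (in $\{1,\dotsc,n\}$) and $\infty$ is larger than every integer (these encode tilings of a cylinder of circumference $n$ and height $\mu_0+d-1$ by unit squares and translates of the Ferrers tile of $\mu$, with tile lower-left cells in column $i$, row $a_i$). $\mathrm{bigtiles}(w)$ is the number of non-$\infty$ letters. An (ordinary) anchor word of length $n$ is a word $a_1\cdots a_n$ over the same alphabet with $a_i\neq\infty\Rightarrow a_{i+k}\geq a_i+\mu_k$ for $k=1,\dotsc,\ell$ and $a_{n-\ell+1}=\cdots=a_n=\infty$; it is fault-free if it is $(\infty)$ or starts with an integer, ends with $\ell$ consecutive $\infty$'s, and that final block is the only occurrence of $\ell$ consecutive $\infty$'s. $B_{\mu,d}(x,t)=\sum x^{\mathrm{length}(w)}t^{\mathrm{bigtiles}(w)}$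 over fault-free anchor words $w$. -}

module Defs where

open import Data.Bool using (Bool; true; false; _∧_; _∨_; not; if_then_else_)
open import Data.Nat using (ℕ; zero; suc; _+_; _*_; _∸_; _≤ᵇ_; _<ᵇ_; _≡ᵇ_)
open import Data.Nat.DivMod using (_%_)
open import Data.Maybe using (Maybe; just; nothing)
open import Data.List using (List; []; _∷_; length; map; concatMap; upTo; filterᵇ)
open import Data.Nat.ListAction using (sum)

-- A letter: `nothing` is ∞, `just a` is the integer a (with 1 ≤ a ≤ d in enumerated words).
Letter : Set
Letter = Maybe ℕ

Word : Set
Word = List Letter

letters : ℕ → List Letter
letters d = nothing ∷ map (λ i → just (suc i)) (upTo d)

words : ℕ → ℕ → List Word
words d zero    = [] ∷ []
words d (suc n) = concatMap (λ a → map (a ∷_) (words d n)) (letters d)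

-- 0-indexed letter lookup (out of range ↦ ∞; never used out of range below)
at : Word → ℕ → Letter
at []       _       = nothing
at (a ∷ w)  zero    = a
at (a ∷ w)  (suc i) = at w i

isInf : Letter → Bool
isInf nothing  = true
isInf (just _) = false

geL : Letter → ℕ → Bool
geL nothing  v = true
geL (just a) v = v ≤ᵇ a

allBelow : ℕ → (ℕ → Bool) → Bool
allBelow zero    p = true
allBelow (suc n) p = allBelow n p ∧ p n

-- check f k μ_k for k = 1,…,ℓ where the list is μ₁ ∷ … ∷ μ_ℓ
allK : (ℕ → ℕ → Bool) → List ℕ → Bool
allK f = go 1
  where
  go : ℕ → List ℕ → Bool
  go k []       = true
  go k (m ∷ ms) = f k m ∧ go (suc k) ms

bigtiles : Word → ℕ
bigtiles []             = 0
bigtiles (nothing ∷ w)  = bigtiles w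
bigtiles (just _ ∷ w)   = suc (bigtiles w)

-- cylindric anchor word condition (positions 0-indexed, cyclic mod n)
cylindric : List ℕ → Word → Bool
cylindric μs []        = false
cylindric μs w@(_ ∷ w') =
  allBelow n (λ i → check i (at w i))
  where
  n = suc (length w')
  check : ℕ → Letter → Bool
  check i nothing  = true
  check i (just v) = allK (λ k m → geL (at w ((i + k) % n)) (v + m)) μs

anchor : List ℕ → Word → Bool
anchor μs w =
  (ℓ ≤ᵇ n)
  ∧ allBelow n (λ i → (not ((n ∸ ℓ) ≤ᵇ i)) ∨ isInf (at w i))
  ∧ allBelow n (λ i → check i (at w i))
  where
  n = length w
  ℓ = length μs
  check : ℕ → Letter → Bool
  check i nothing  = true
  check i (just v) = allK (λ k m → not ((i + k) <ᵇ n) ∨ geL (at w (i + k)) (v + m)) μs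

startsInt : Word → Bool
startsInt (just _ ∷ _) = true
startsInt _            = false

isSingleInf : Word → Bool
isSingleInf (nothing ∷ []) = true
isSingleInf _              = false

infWindow : Word → ℕ → ℕ → Bool
infWindow w ℓ j = allBelow ℓ (λ r → isInf (at w (j + r)))

faultFree : List ℕ → Word → Bool
faultFree μs w =
  isSingleInf w ∨
  (anchor μs w ∧ startsInt w
    ∧ allBelow (suc (n ∸ ℓ)) (λ j → (j ≡ᵇ (n ∸ ℓ)) ∨ not (infWindow w ℓ j)))
  where
  n = length w
  ℓ = length μs

count : (Word → Bool) → ℕ → ℕ → ℕ → ℕ
count P d n k = length (filterᵇ (λ w → P w ∧ (bigtiles w ≡ᵇ k)) (words d n))

-- Formal power series in x, t with ℕ coefficients: F n k = [x^n t^k] F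

Series : Set
Series = ℕ → ℕ → ℕ

oneS : Series
oneS zero    zero    = 1
oneS _       _       = 0

_⊕_ : Series → Series → Series
(F ⊕ G) n k = F n k + G n k

_⊛_ : Series → Series → Series
(F ⊛ G) n k = sum (map (λ i → sum (map (λ j → F i j * G (n ∸ i) (k ∸ j)) (upTo (suc k)))) (upTo (suc n)))

xD : Series → Series
xD F n k = n * F n k

powS : Series → ℕ → Series
powS F zero    = oneS
powS F (suc m) = F ⊛ powS F m

-- 1/(1 - F) = Σ_{m ≥ 0} F^m, for F with zero x^0 coefficients
-- (then only m ≤ n contribute to [x^n]).
geomS : Series → Series
geomS F n k = sum (map (λ m → powS F m n k) (upTo (suc n)))

-- B_{μ,d}(x,t), μs = (μ₁,…,μ_ℓ)
Bser : List ℕ → ℕ → Series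
Bser μs d n k = count (faultFree μs) d n k

Cser : List ℕ → ℕ → Series
Cser μs d zero    k = oneS zero k
Cser μs d (suc n) k = count (cylindric μs) d (suc n) k

{-# OPTIONS --safe #-}

-- Let B count fault-free words and L linear words, i.e. anchor words without the
-- condition ℓ ≤ length. A nonempty linear word is cut at its first fault (the first
-- position preceded by ℓ letters ∞) into a fault-free word and a linear word, and this
-- factorisation is unique, so L = 1 + B·L; as B has no constant term, L = 1/(1 − B).
-- The cyclic faults of a cylindric word c of length n cut it into fault-free blocks.
-- If the block containing position 0 starts at s and has length i, then c rotated by s
-- is a linear word whose first factor has length i and contains position 0 of c, at
-- p = n − s < i. Conversely, whenever c rotated by n − p is linear with a first factor
-- of length i > p, that factor is the block of c containing position 0, and c is
-- cylindric. Since rotations permute the words of length n, C − 1 counts linear words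
-- with a marked letter in their first factor: C = 1 + (x ∂B/∂x)·L.

module Submission where

open import Defs
open import Data.Nat using (ℕ; zero; suc; _+_; _*_; _∸_; _≤_; _<_; _≥_; z≤n; s≤s; _≤ᵇ_; _<ᵇ_; _≡ᵇ_; _%_; _⊔_)
open import Data.Nat.DivMod using (m<n⇒m%n≡m; [m+n]%n≡m%n; %-distribˡ-+; m%n%n≡m%n; m%n<n)
open import Data.Nat.Properties
open import Data.Bool using (Bool; true; false; _∧_; _∨_; not)
open import Data.Bool.Properties using (T-≡)
open import Data.Maybe using (just; nothing)
open import Data.List using (List; []; _∷_; length; map; concatMap; concat; upTo; applyUpTo; filterᵇ; _++_; take; drop)
open import Data.List.Properties using (map-++; length-++; length-take; length-drop; take++drop≡id)
open import Data.Nat.ListAction using (sum)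
open import Data.Nat.ListAction.Properties using (sum-++)
open import Data.Product using (∃-syntax; _×_; _,_; proj₁; proj₂)
open import Data.Sum using (_⊎_; inj₁; inj₂)
open import Data.List.Relation.Unary.All using (All; _∷_)
open import Data.List.Relation.Unary.Linked using (Linked)
open import Data.Empty using (⊥; ⊥-elim)
open import Function using (id; _∘_; Equivalence)
open import Relation.Nullary using (¬_; yes; no; Dec; _×-dec_; _→-dec_)
open import Relation.Nullary.Decidable using (map′)
open import Relation.Binary.PropositionalEquality
open import Relation.Binary.Definitions using (tri<; tri≈; tri>)
open import Data.Nat.Induction using (<-rec)
open import Data.Nat.Tactic.RingSolver using (solve-∀)
open import Algebra.Properties.CommutativeSemigroup +-commutativeSemigroup using (interchange; x∙yz≈y∙zx; x∙yz≈xz∙y; xy∙z≈xz∙y)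
open import Algebra.Properties.CommutativeSemigroup *-commutativeSemigroup using () renaming (interchange to *-interchange)

𝟙 : Bool → ℕ
𝟙 true  = 1
𝟙 false = 0

𝟙-∧ : ∀ a b → 𝟙 (a ∧ b) ≡ 𝟙 a * 𝟙 b
𝟙-∧ true  b = sym (+-identityʳ (𝟙 b))
𝟙-∧ false b = refl

𝟙-true : ∀ {b} → b ≡ true → 𝟙 b ≡ 1
𝟙-true refl = refl

𝟙-≢true : ∀ {b} → b ≢ true → 𝟙 b ≡ 0
𝟙-≢true {false} _  = refl
𝟙-≢true {true}  ¬b = ⊥-elim (¬b refl)

true≢false : ∀ {b} → b ≡ true → b ≡ false → ⊥
true≢false refl ()

∧-trueˡ : ∀ a {b} → a ∧ b ≡ true → a ≡ true
∧-trueˡ true _ = refl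

∧-trueʳ : ∀ a {b} → a ∧ b ≡ true → b ≡ true
∧-trueʳ true e = e

∧-true : ∀ {a b} → a ≡ true → b ≡ true → a ∧ b ≡ true
∧-true refl refl = refl

∧-false : ∀ a {b} → a ∧ b ≡ false → a ≡ false ⊎ b ≡ false
∧-false true  e = inj₂ e
∧-false false _ = inj₁ refl

∨-true : ∀ a {b} → a ∨ b ≡ true → a ≡ true ⊎ b ≡ true
∨-true true  _ = inj₁ refl
∨-true false e = inj₂ e

not-true : ∀ {b} → not b ≡ true → b ≡ false
not-true {false} _ = refl

≤ᵇ-true⇒≤ : ∀ {m n} → (m ≤ᵇ n) ≡ true → m ≤ n
≤ᵇ-true⇒≤ e = ≤ᵇ⇒≤ _ _ (Equivalence.from T-≡ e)

≤⇒≤ᵇ-true : ∀ {m n} → m ≤ n → (m ≤ᵇ n) ≡ true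
≤⇒≤ᵇ-true p = Equivalence.to T-≡ (≤⇒≤ᵇ p)

<ᵇ-true⇒< : ∀ {m n} → (m <ᵇ n) ≡ true → m < n
<ᵇ-true⇒< e = <ᵇ⇒< _ _ (Equivalence.from T-≡ e)

<⇒<ᵇ-true : ∀ {m n} → m < n → (m <ᵇ n) ≡ true
<⇒<ᵇ-true p = Equivalence.to T-≡ (<⇒<ᵇ p)

≡ᵇ-true⇒≡ : ∀ {m n} → (m ≡ᵇ n) ≡ true → m ≡ n
≡ᵇ-true⇒≡ e = ≡ᵇ⇒≡ _ _ (Equivalence.from T-≡ e)

≡⇒≡ᵇ-true : ∀ {m n} → m ≡ n → (m ≡ᵇ n) ≡ true
≡⇒≡ᵇ-true {m} {n} p = Equivalence.to T-≡ (≡⇒≡ᵇ m n p)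

+-wrap : ∀ a b c d → a + (b + c) + d ≡ b + d + (a + c)
+-wrap = solve-∀

∸≤⇒≤+ : ∀ {m n o} → m ∸ n ≤ o → m ≤ o + n
∸≤⇒≤+ {m} {n} {o} m∸n≤o = ≤-trans (m≤n+m∸n m n) (≤-trans (+-monoʳ-≤ n m∸n≤o) (≤-reflexive (+-comm n o)))

≤+⇒∸≤ : ∀ {m n o} → m ≤ o + n → m ∸ n ≤ o
≤+⇒∸≤ {m} {n} {o} m≤o+n = m≤n+o⇒m∸n≤o m n (≤-trans m≤o+n (≤-reflexive (+-comm o n)))

<∸⇒+< : ∀ {a b c} → a < b ∸ c → a + c < b
<∸⇒+< {a} {b} {c} a<b∸c with c ≤? b
... | yes c≤b = m≤o∸n⇒m+n≤o (suc a) c≤b a<b∸c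
... | no c≰b  = ⊥-elim (<⇒≱ a<b∸c (≤-trans (≤-reflexive (m≤n⇒m∸n≡0 (<⇒≤ (≰⇒> c≰b)))) z≤n))

[m+n]∸o≤m+p⇒n∸o≤p : ∀ m {n o p} → (m + n) ∸ o ≤ m + p → n ∸ o ≤ p
[m+n]∸o≤m+p⇒n∸o≤p m {n} {o} {p} h = ≤+⇒∸≤ (+-cancelˡ-≤ m n (p + o) (≤-trans (∸≤⇒≤+ h) (≤-reflexive (+-assoc m p o))))

n∸o≤p⇒[m+n]∸o≤m+p : ∀ m {n o p} → n ∸ o ≤ p → (m + n) ∸ o ≤ m + p
n∸o≤p⇒[m+n]∸o≤m+p m {n} {o} {p} h = ≤+⇒∸≤ (≤-trans (+-monoʳ-≤ m (∸≤⇒≤+ h)) (≤-reflexive (sym (+-assoc m p o))))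

data Position (n : ℕ) : ℕ → Set where
  before : ∀ {p} → p < n → Position n p
  after  : ∀ p → Position n (n + p)

position : ∀ n p → Position n p
position n p with p <? n
... | yes p<n = before p<n
... | no p≮n  = subst (Position n) (m+[n∸m]≡n (≮⇒≥ p≮n)) (after (p ∸ n))

least : {P : ℕ → Set} → (∀ q → Dec (P q)) → ∀ m → P m → ∃[ i ] i ≤ m × P i × (∀ q → q < i → ¬ P q)
least {P} P? = <-rec (λ m → P m → ∃[ i ] i ≤ m × P i × (∀ q → q < i → ¬ P q)) step
  where
  step : ∀ m → (∀ {q} → q < m → P q → ∃[ i ] i ≤ q × P i × (∀ q′ → q′ < i → ¬ P q′)) →
         P m → ∃[ i ] i ≤ m × P i × (∀ q → q < i → ¬ P q)
  step m smaller Pm with anyUpTo? P? m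
  ... | yes (q , q<m , Pq) = let i , i≤q , Pi , minimal = smaller q<m Pq in i , ≤-trans i≤q (<⇒≤ q<m) , Pi , minimal
  ... | no ¬below         = m , ≤-refl , Pm , λ q q<m Pq → ¬below (q , q<m , Pq)

greatest : {P : ℕ → Set} → (∀ t → Dec (P t)) → ∀ N {t₀} → t₀ ≤ N → P t₀ →
           ∃[ t ] t ≤ N × P t × (∀ t′ → t < t′ → t′ ≤ N → ¬ P t′)
greatest P? zero    z≤n Pt₀ = 0 , z≤n , Pt₀ , λ t′ 0<t′ t′≤0 _ → <⇒≱ 0<t′ t′≤0
greatest {P} P? (suc N) t₀≤1+N Pt₀ with P? (suc N) | m≤n⇒m<n∨m≡n t₀≤1+N
... | yes P1+N | _              = suc N , ≤-refl , P1+N , λ t′ 1+N<t′ t′≤1+N _ → <⇒≱ 1+N<t′ t′≤1+N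
... | no ¬P1+N | inj₂ refl      = ⊥-elim (¬P1+N Pt₀)
... | no ¬P1+N | inj₁ (s≤s t₀≤N) with greatest P? N t₀≤N Pt₀
...   | t , t≤N , Pt , maximal = t , m≤n⇒m≤1+n t≤N , Pt , maximal′
  where
  maximal′ : ∀ t′ → t < t′ → t′ ≤ suc N → ¬ P t′
  maximal′ t′ t<t′ t′≤1+N with m≤n⇒m<n∨m≡n t′≤1+N
  ... | inj₁ (s≤s t′≤N) = maximal t′ t<t′ t′≤N
  ... | inj₂ refl       = ¬P1+N

∑< : ℕ → (ℕ → ℕ) → ℕ
∑< zero    f = 0
∑< (suc n) f = ∑< n f + f n

infix 5 ∑<
syntax ∑< n (λ i → e) = ∑[ i < n ] e

∑∈ : {A : Set} → List A → (A → ℕ) → ℕ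
∑∈ xs f = sum (map f xs)

infix 5 ∑∈
syntax ∑∈ xs (λ x → e) = ∑[ x ∈ xs ] e

∑∈-cong : {A : Set} (xs : List A) {f g : A → ℕ} → (∀ x → f x ≡ g x) → ∑∈ xs f ≡ ∑∈ xs g
∑∈-cong []       e = refl
∑∈-cong (x ∷ xs) e = cong₂ _+_ (e x) (∑∈-cong xs e)

∑∈-zero : {A : Set} (xs : List A) → ∑[ x ∈ xs ] 0 ≡ 0
∑∈-zero []       = refl
∑∈-zero (x ∷ xs) = ∑∈-zero xs

∑∈-++ : {A : Set} (xs ys : List A) (f : A → ℕ) → ∑∈ (xs ++ ys) f ≡ ∑∈ xs f + ∑∈ ys f
∑∈-++ xs ys f = trans (cong sum (map-++ f xs ys)) (sum-++ (map f xs) (map f ys))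

∑∈-map : {A B : Set} (h : A → B) (xs : List A) (f : B → ℕ) → ∑∈ (map h xs) f ≡ ∑[ x ∈ xs ] f (h x)
∑∈-map h []       f = refl
∑∈-map h (x ∷ xs) f = cong (f (h x) +_) (∑∈-map h xs f)

∑∈-concatMap : {A B : Set} (g : A → List B) (xs : List A) (f : B → ℕ) →
               ∑∈ (concatMap g xs) f ≡ ∑[ x ∈ xs ] ∑∈ (g x) f
∑∈-concatMap g []       f = refl
∑∈-concatMap g (x ∷ xs) f =
  trans (∑∈-++ (g x) (concat (map g xs)) f) (cong (∑∈ (g x) f +_) (∑∈-concatMap g xs f))

∑∈-+ : {A : Set} (xs : List A) (f g : A → ℕ) → ∑[ x ∈ xs ] (f x + g x) ≡ ∑∈ xs f + ∑∈ xs g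
∑∈-+ []       f g = refl
∑∈-+ (x ∷ xs) f g = trans (cong (f x + g x +_) (∑∈-+ xs f g)) (interchange (f x) (g x) _ _)

∑∈-*ˡ : {A : Set} (c : ℕ) (xs : List A) (f : A → ℕ) → c * ∑∈ xs f ≡ ∑[ x ∈ xs ] c * f x
∑∈-*ˡ c []       f = *-zeroʳ c
∑∈-*ˡ c (x ∷ xs) f = trans (*-distribˡ-+ c (f x) _) (cong (c * f x +_) (∑∈-*ˡ c xs f))

∑∈-*ʳ : {A : Set} (c : ℕ) (xs : List A) (f : A → ℕ) → ∑∈ xs f * c ≡ ∑[ x ∈ xs ] f x * c
∑∈-*ʳ c xs f = trans (*-comm _ c) (trans (∑∈-*ˡ c xs f) (∑∈-cong xs (λ x → *-comm c (f x))))

∑∈-comm : {A B : Set} (xs : List A) (ys : List B) (f : A → B → ℕ) →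
          ∑[ x ∈ xs ] ∑∈ ys (f x) ≡ ∑[ y ∈ ys ] ∑[ x ∈ xs ] f x y
∑∈-comm []       ys f = sym (∑∈-zero ys)
∑∈-comm (x ∷ xs) ys f =
  trans (cong (∑∈ ys (f x) +_) (∑∈-comm xs ys f)) (sym (∑∈-+ ys (f x) (λ y → ∑[ x ∈ xs ] f x y)))

∑<-cong : ∀ n {f g : ℕ → ℕ} → (∀ i → i < n → f i ≡ g i) → ∑< n f ≡ ∑< n g
∑<-cong zero    e = refl
∑<-cong (suc n) e = cong₂ _+_ (∑<-cong n (λ i i<n → e i (m<n⇒m<1+n i<n))) (e n ≤-refl)

∑<-vanish : ∀ n {f : ℕ → ℕ} → (∀ i → i < n → f i ≡ 0) → ∑< n f ≡ 0
∑<-vanish n e = trans (∑<-cong n e) (∑<-zero n)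
  where
  ∑<-zero : ∀ n → ∑[ i < n ] 0 ≡ 0
  ∑<-zero zero    = refl
  ∑<-zero (suc n) = cong (_+ 0) (∑<-zero n)

∑<-+ : ∀ n (f g : ℕ → ℕ) → ∑[ i < n ] (f i + g i) ≡ ∑< n f + ∑< n g
∑<-+ zero    f g = refl
∑<-+ (suc n) f g = trans (cong (_+ (f n + g n)) (∑<-+ n f g)) (interchange (∑< n f) (∑< n g) (f n) (g n))

∑<-*ˡ : ∀ c n (f : ℕ → ℕ) → c * ∑< n f ≡ ∑[ i < n ] c * f i
∑<-*ˡ c zero    f = *-zeroʳ c
∑<-*ˡ c (suc n) f = trans (*-distribˡ-+ c (∑< n f) (f n)) (cong (_+ c * f n) (∑<-*ˡ c n f))

∑<-*ʳ : ∀ c n (f : ℕ → ℕ) → ∑< n f * c ≡ ∑[ i < n ] f i * c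
∑<-*ʳ c n f = trans (*-comm _ c) (trans (∑<-*ˡ c n f) (∑<-cong n (λ i _ → *-comm c (f i))))

∑<-∑∈-comm : {A : Set} (n : ℕ) (xs : List A) (f : ℕ → A → ℕ) →
             ∑[ i < n ] ∑∈ xs (f i) ≡ ∑[ x ∈ xs ] ∑[ i < n ] f i x
∑<-∑∈-comm zero    xs f = sym (∑∈-zero xs)
∑<-∑∈-comm (suc n) xs f =
  trans (cong (_+ ∑∈ xs (f n)) (∑<-∑∈-comm n xs f)) (sym (∑∈-+ xs (λ x → ∑[ i < n ] f i x) (f n)))

∑<-comm : ∀ n m (f : ℕ → ℕ → ℕ) → ∑[ i < n ] ∑< m (f i) ≡ ∑[ j < m ] ∑[ i < n ] f i j
∑<-comm zero    m f = sym (∑<-vanish m (λ _ _ → refl))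
∑<-comm (suc n) m f =
  trans (cong (_+ ∑< m (f n)) (∑<-comm n m f)) (sym (∑<-+ m (λ j → ∑[ i < n ] f i j) (f n)))

∑<-const : ∀ n c → ∑[ i < n ] c ≡ n * c
∑<-const zero    c = refl
∑<-const (suc n) c = trans (cong (_+ c) (∑<-const n c)) (+-comm (n * c) c)

∑<-sucˡ : ∀ n (f : ℕ → ℕ) → ∑< (suc n) f ≡ f 0 + (∑[ i < n ] f (suc i))
∑<-sucˡ zero    f = sym (+-identityʳ (f 0))
∑<-sucˡ (suc n) f = trans (cong (_+ f (suc n)) (∑<-sucˡ n f)) (+-assoc (f 0) _ _)

∑<-single : ∀ n (f : ℕ → ℕ) i₀ → i₀ < n → (∀ i → i < n → i ≢ i₀ → f i ≡ 0) → ∑< n f ≡ f i₀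
∑<-single (suc n) f i₀ i₀<1+n e with i₀ ≟ n
... | yes refl = cong (_+ f i₀) (∑<-vanish n (λ i i<n → e i (m<n⇒m<1+n i<n) (<⇒≢ i<n)))
... | no i₀≢n = trans (cong₂ _+_ (∑<-single n f i₀ (≤∧≢⇒< (≤-pred i₀<1+n) i₀≢n) (λ i i<n → e i (m<n⇒m<1+n i<n)))
                                 (e n ≤-refl (i₀≢n ∘ sym)))
                      (+-identityʳ (f i₀))

∑<-truncate : ∀ a b (f : ℕ → ℕ) → a ≤ b → (∀ i → a ≤ i → i < b → f i ≡ 0) → ∑< b f ≡ ∑< a f
∑<-truncate a zero    f z≤n _ = refl
∑<-truncate a (suc b) f a≤1+b e with a ≟ suc b
... | yes refl = refl
... | no a≢1+b = trans (cong₂ _+_ (∑<-truncate a b f a≤b (λ i a≤i i<b → e i a≤i (m<n⇒m<1+n i<b))) (e b a≤b ≤-refl))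
                       (+-identityʳ _)
  where
  a≤b : a ≤ b
  a≤b = ≤-pred (≤∧≢⇒< a≤1+b a≢1+b)

sum-map-upTo : ∀ n (f : ℕ → ℕ) → sum (map f (upTo n)) ≡ ∑< n f
sum-map-upTo n f = go n id
  where
  go : ∀ n (g : ℕ → ℕ) → sum (map f (applyUpTo g n)) ≡ ∑[ i < n ] f (g i)
  go zero    g = refl
  go (suc n) g = trans (cong (f (g 0) +_) (go n (g ∘ suc))) (sym (∑<-sucˡ n (f ∘ g)))

wordSeries : (Word → Bool) → ℕ → Series
wordSeries P d n k = ∑[ w ∈ words d n ] 𝟙 (P w) * 𝟙 (bigtiles w ≡ᵇ k)

count≡wordSeries : ∀ P d n k → count P d n k ≡ wordSeries P d n k
count≡wordSeries P d n k = go (words d n)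
  where
  go : (ws : List Word) → length (filterᵇ (λ w → P w ∧ (bigtiles w ≡ᵇ k)) ws)
                          ≡ ∑[ w ∈ ws ] 𝟙 (P w) * 𝟙 (bigtiles w ≡ᵇ k)
  go []       = refl
  go (w ∷ ws) with P w | bigtiles w ≡ᵇ k
  ... | true  | true  = cong suc (go ws)
  ... | true  | false = go ws
  ... | false | _     = go ws

∑-words-suc : ∀ d n (f : Word → ℕ) →
              ∑∈ (words d (suc n)) f ≡ ∑[ a ∈ letters d ] ∑[ w ∈ words d n ] f (a ∷ w)
∑-words-suc d n f = trans (∑∈-concatMap (λ a → map (a ∷_) (words d n)) (letters d) f)
                          (∑∈-cong (letters d) (λ a → ∑∈-map (a ∷_) (words d n) f))

∑-words-cong : ∀ d n {f g : Word → ℕ} → (∀ w → length w ≡ n → f w ≡ g w) →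
               ∑∈ (words d n) f ≡ ∑∈ (words d n) g
∑-words-cong d zero    e = cong (_+ 0) (e [] refl)
∑-words-cong d (suc n) {f} {g} e = begin
  ∑∈ (words d (suc n)) f
    ≡⟨ ∑-words-suc d n f ⟩
  ∑[ a ∈ letters d ] ∑[ w ∈ words d n ] f (a ∷ w)
    ≡⟨ ∑∈-cong (letters d) (λ a → ∑-words-cong d n (λ w ∣w∣≡n → e (a ∷ w) (cong suc ∣w∣≡n))) ⟩
  ∑[ a ∈ letters d ] ∑[ w ∈ words d n ] g (a ∷ w)
    ≡⟨ ∑-words-suc d n g ⟨
  ∑∈ (words d (suc n)) g
    ∎
  where open ≡-Reasoning

∑-words-++ : ∀ d a b (f : Word → ℕ) →
             ∑∈ (words d (a + b)) f ≡ ∑[ u ∈ words d a ] ∑[ v ∈ words d b ] f (u ++ v)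
∑-words-++ d zero    b f = sym (+-identityʳ _)
∑-words-++ d (suc a) b f = begin
  ∑∈ (words d (suc a + b)) f
    ≡⟨ ∑-words-suc d (a + b) f ⟩
  ∑[ x ∈ letters d ] ∑[ w ∈ words d (a + b) ] f (x ∷ w)
    ≡⟨ ∑∈-cong (letters d) (λ x → ∑-words-++ d a b (f ∘ (x ∷_))) ⟩
  ∑[ x ∈ letters d ] ∑[ u ∈ words d a ] ∑[ v ∈ words d b ] f (x ∷ u ++ v)
    ≡⟨ ∑-words-suc d a _ ⟨
  ∑[ u ∈ words d (suc a) ] ∑[ v ∈ words d b ] f (u ++ v)
    ∎
  where open ≡-Reasoning

take-length-++ : {A : Set} (u v : List A) → take (length u) (u ++ v) ≡ u
take-length-++ []      v = refl
take-length-++ (x ∷ u) v = cong (x ∷_) (take-length-++ u v)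

drop-length-++ : {A : Set} (u v : List A) → drop (length u) (u ++ v) ≡ v
drop-length-++ []      v = refl
drop-length-++ (x ∷ u) v = drop-length-++ u v

rotate : ℕ → Word → Word
rotate t c = drop t c ++ take t c

rotate-++ : ∀ u v → rotate (length u) (u ++ v) ≡ v ++ u
rotate-++ u v = cong₂ _++_ (drop-length-++ u v) (take-length-++ u v)

∑-words-rotate : ∀ d n t (f : Word → ℕ) → t ≤ n →
                 ∑∈ (words d n) f ≡ ∑[ c ∈ words d n ] f (rotate t c)
∑-words-rotate d n t f t≤n = begin
  ∑∈ (words d n) f
    ≡⟨ cong (λ m → ∑∈ (words d m) f) (m∸n+n≡m t≤n) ⟨
  ∑∈ (words d (n ∸ t + t)) f
    ≡⟨ ∑-words-++ d (n ∸ t) t f ⟩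
  ∑[ v ∈ words d (n ∸ t) ] ∑[ u ∈ words d t ] f (v ++ u)
    ≡⟨ ∑∈-comm (words d t) (words d (n ∸ t)) _ ⟨
  ∑[ u ∈ words d t ] ∑[ v ∈ words d (n ∸ t) ] f (v ++ u)
    ≡⟨ ∑-words-cong d t (λ u ∣u∣≡t → ∑∈-cong (words d (n ∸ t)) λ v →
         cong f (subst (λ s → rotate s (u ++ v) ≡ v ++ u) ∣u∣≡t (rotate-++ u v))) ⟨
  ∑[ u ∈ words d t ] ∑[ v ∈ words d (n ∸ t) ] f (rotate t (u ++ v))
    ≡⟨ ∑-words-++ d t (n ∸ t) (f ∘ rotate t) ⟨
  ∑∈ (words d (t + (n ∸ t))) (f ∘ rotate t)
    ≡⟨ cong (λ m → ∑∈ (words d m) (f ∘ rotate t)) (m+[n∸m]≡n t≤n) ⟩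
  ∑∈ (words d n) (f ∘ rotate t)
    ∎
  where open ≡-Reasoning

bigtiles-++ : ∀ u v → bigtiles (u ++ v) ≡ bigtiles u + bigtiles v
bigtiles-++ []            v = refl
bigtiles-++ (nothing ∷ u) v = bigtiles-++ u v
bigtiles-++ (just _ ∷ u)  v = cong suc (bigtiles-++ u v)

bigtiles-rotate : ∀ t c → bigtiles (rotate t c) ≡ bigtiles c
bigtiles-rotate t c = begin
  bigtiles (drop t c ++ take t c)           ≡⟨ bigtiles-++ (drop t c) (take t c) ⟩
  bigtiles (drop t c) + bigtiles (take t c) ≡⟨ +-comm (bigtiles (drop t c)) _ ⟩
  bigtiles (take t c) + bigtiles (drop t c) ≡⟨ bigtiles-++ (take t c) (drop t c) ⟨
  bigtiles (take t c ++ drop t c)           ≡⟨ cong bigtiles (take++drop≡id t c) ⟩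
  bigtiles c                                ∎
  where open ≡-Reasoning

length-rotate : ∀ t c → length (rotate t c) ≡ length c
length-rotate t c = begin
  length (drop t c ++ take t c)         ≡⟨ length-++ (drop t c) ⟩
  length (drop t c) + length (take t c) ≡⟨ +-comm (length (drop t c)) _ ⟩
  length (take t c) + length (drop t c) ≡⟨ length-++ (take t c) ⟨
  length (take t c ++ drop t c)         ≡⟨ cong length (take++drop≡id t c) ⟩
  length c                              ∎
  where open ≡-Reasoning

length-take-≤ : {A : Set} (i : ℕ) (y : List A) → i ≤ length y → length (take i y) ≡ i
length-take-≤ i y i≤∣y∣ = trans (length-take i y) (m≤n⇒m⊓n≡m i≤∣y∣)

at-take : ∀ y i p → p < i → at (take i y) p ≡ at y p
at-take []      zero    p       _         = refl
at-take []      (suc i) p       _         = refl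
at-take (x ∷ y) (suc i) zero    _         = refl
at-take (x ∷ y) (suc i) (suc p) (s≤s p<i) = at-take y i p p<i

at-drop : ∀ y i p → at (drop i y) p ≡ at y (i + p)
at-drop y       zero    p       = refl
at-drop []      (suc i) zero    = refl
at-drop []      (suc i) (suc p) = refl
at-drop (x ∷ y) (suc i) p       = at-drop y i p

at-++ˡ : ∀ u v p → p < length u → at (u ++ v) p ≡ at u p
at-++ˡ (x ∷ u) v zero    _         = refl
at-++ˡ (x ∷ u) v (suc p) (s≤s p<∣u∣) = at-++ˡ u v p p<∣u∣

at-++ʳ : ∀ u v p → at (u ++ v) (length u + p) ≡ at v p
at-++ʳ []      v p = refl
at-++ʳ (x ∷ u) v p = at-++ʳ u v p

at-++ʳ-+ : ∀ u v p q → at (u ++ v) (length u + p + q) ≡ at v (p + q)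
at-++ʳ-+ u v p q = trans (cong (at (u ++ v)) (+-assoc (length u) p q)) (at-++ʳ u v (p + q))

at-just⇒< : ∀ w p {v} → at w p ≡ just v → p < length w
at-just⇒< (x ∷ w) zero    _ = s≤s z≤n
at-just⇒< (x ∷ w) (suc p) e = s≤s (at-just⇒< w p e)

maxLetter : Word → ℕ
maxLetter []            = 0
maxLetter (nothing ∷ w) = maxLetter w
maxLetter (just a ∷ w)  = a ⊔ maxLetter w

maxLetter-upper : ∀ w p {b} → at w p ≡ just b → b ≤ maxLetter w
maxLetter-upper (nothing ∷ w) (suc p) e    = maxLetter-upper w p e
maxLetter-upper (just a ∷ w)  zero    refl = m≤m⊔n a (maxLetter w)
maxLetter-upper (just a ∷ w)  (suc p) e    = ≤-trans (maxLetter-upper w p e) (m≤n⊔m a (maxLetter w))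

maxLetter-attained : ∀ w → (∀ p → at w p ≡ nothing) ⊎ (∃[ p ] at w p ≡ just (maxLetter w))
maxLetter-attained [] = inj₁ λ _ → refl
maxLetter-attained (nothing ∷ w) with maxLetter-attained w
... | inj₁ allInf      = inj₁ λ { zero → refl ; (suc p) → allInf p }
... | inj₂ (p , wₚ≡max) = inj₂ (suc p , wₚ≡max)
maxLetter-attained (just a ∷ w) with maxLetter w ≤? a | maxLetter-attained w
... | yes max≤a | _                  = inj₂ (0 , cong just (sym (m≥n⇒m⊔n≡m max≤a)))
... | no max≰a  | inj₂ (p , wₚ≡max) = inj₂ (suc p , trans wₚ≡max (cong just (sym (m≤n⇒m⊔n≡n (<⇒≤ (≰⇒> max≰a))))))
... | no max≰a  | inj₁ allInf        = ⊥-elim (max≰a (≤-trans (≤-reflexive (noLetters w allInf)) z≤n))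
  where
  noLetters : ∀ w → (∀ p → at w p ≡ nothing) → maxLetter w ≡ 0
  noLetters []            _      = refl
  noLetters (nothing ∷ w) allInf = noLetters w (allInf ∘ suc)
  noLetters (just _ ∷ w)  allInf with () ← allInf 0

allBelow-elim : ∀ {n p} → allBelow n p ≡ true → ∀ i → i < n → p i ≡ true
allBelow-elim {suc n} {p} e i i<1+n with i ≟ n
... | yes refl = ∧-trueʳ (allBelow n p) e
... | no i≢n   = allBelow-elim {n} (∧-trueˡ (allBelow n p) e) i (≤∧≢⇒< (≤-pred i<1+n) i≢n)

allBelow-intro : ∀ {n p} → (∀ i → i < n → p i ≡ true) → allBelow n p ≡ true
allBelow-intro {zero}  h = refl
allBelow-intro {suc n} h = ∧-true (allBelow-intro {n} (λ i i<n → h i (m<n⇒m<1+n i<n))) (h n ≤-refl)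

allBelow-false : ∀ {n p} → allBelow n p ≡ false → ∃[ i ] i < n × p i ≡ false
allBelow-false {suc n} {p} e with ∧-false (allBelow n p) e
... | inj₂ pn≡false = n , ≤-refl , pn≡false
... | inj₁ e′ with allBelow-false {n} e′
...   | i , i<n , pi≡false = i , m<n⇒m<1+n i<n , pi≡false

-- The loop of allK is local to its definition; it is determined by its defining equations.
allKFrom : (ℕ → ℕ → Bool) → ℕ → List ℕ → Bool
allKFrom f k []       = true
allKFrom f k (m ∷ ms) = f k m ∧ allKFrom f (suc k) ms

allKFrom-unique : ∀ f {G : ℕ → List ℕ → Bool} → (∀ k → G k [] ≡ true) →
                  (∀ k m ms → G k (m ∷ ms) ≡ f k m ∧ G (suc k) ms) → ∀ k ms → G k ms ≡ allKFrom f k ms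
allKFrom-unique f nil cons k []       = nil k
allKFrom-unique f {G} nil cons k (m ∷ ms) = trans (cons k m ms) (cong (f k m ∧_) (allKFrom-unique f {G} nil cons (suc k) ms))

allK≡allKFrom : ∀ f ms → allK f ms ≡ allKFrom f 1 ms
allK≡allKFrom f with 1 | allKFrom-unique f (λ _ → refl) (λ _ _ _ → refl)
... | k | G≡allKFrom = G≡allKFrom k

nth : List ℕ → ℕ → ℕ
nth []       _       = 0
nth (m ∷ ms) zero    = m
nth (m ∷ ms) (suc j) = nth ms j

All-nth : ∀ {P : ℕ → Set} μs → All P μs → ∀ j → j < length μs → P (nth μs j)
All-nth (m ∷ ms) (Pm ∷ _)   zero    _         = Pm
All-nth (m ∷ ms) (_  ∷ Pms) (suc j) (s≤s j<ℓ) = All-nth ms Pms j j<ℓ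

AllK : (ℕ → ℕ → Bool) → List ℕ → Set
AllK f μs = ∀ j → j < length μs → f (suc j) (nth μs j) ≡ true

allK-elim : ∀ f μs → allK f μs ≡ true → AllK f μs
allK-elim f μs e = go 1 μs (trans (sym (allK≡allKFrom f μs)) e)
  where
  go : ∀ k ms → allKFrom f k ms ≡ true → ∀ j → j < length ms → f (k + j) (nth ms j) ≡ true
  go k (m ∷ ms) e zero    _         = subst (λ i → f i m ≡ true) (sym (+-identityʳ k)) (∧-trueˡ (f k m) e)
  go k (m ∷ ms) e (suc j) (s≤s j<ℓ) = subst (λ i → f i (nth ms j) ≡ true) (sym (+-suc k j)) (go (suc k) ms (∧-trueʳ (f k m) e) j j<ℓ)

allK-intro : ∀ f μs → AllK f μs → allK f μs ≡ true
allK-intro f μs h = trans (allK≡allKFrom f μs) (go 1 μs h)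
  where
  go : ∀ k ms → (∀ j → j < length ms → f (k + j) (nth ms j) ≡ true) → allKFrom f k ms ≡ true
  go k []       h = refl
  go k (m ∷ ms) h = ∧-true (subst (λ i → f i m ≡ true) (+-identityʳ k) (h 0 (s≤s z≤n)))
                           (go (suc k) ms (λ j j<ℓ → subst (λ i → f i (nth ms j) ≡ true) (+-suc k j) (h (suc j) (s≤s j<ℓ))))

InfTail : List ℕ → Word → Set
InfTail μs w = ∀ i → i < length w → length w ∸ length μs ≤ i → at w i ≡ nothing

Anchored : List ℕ → Word → Set
Anchored μs w = ∀ i v → at w i ≡ just v → ∀ j → j < length μs → i + suc j < length w →
                geL (at w (i + suc j)) (v + nth μs j) ≡ true

Linear : List ℕ → Word → Set
Linear μs w = Anchored μs w × InfTail μs w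

infTail : List ℕ → Word → Bool
infTail μs w = allBelow (length w) (λ i → not ((length w ∸ length μs) ≤ᵇ i) ∨ isInf (at w i))

anchorCheck : List ℕ → Word → ℕ → Letter → Bool
anchorCheck μs w i nothing  = true
anchorCheck μs w i (just v) = allK (λ k m → not ((i + k) <ᵇ length w) ∨ geL (at w (i + k)) (v + m)) μs

linear : List ℕ → Word → Bool
linear μs w = infTail μs w ∧ allBelow (length w) (λ i → anchorCheck μs w i (at w i))

≟nothing : (l : Letter) → Dec (l ≡ nothing)
≟nothing nothing  = yes refl
≟nothing (just _) = no λ ()

just≢nothing : ∀ {v : ℕ} → just v ≢ nothing
just≢nothing ()

isInf⇒≡nothing : ∀ {l} → isInf l ≡ true → l ≡ nothing
isInf⇒≡nothing {nothing} _ = refl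

infTail⇒InfTail : ∀ μs w → infTail μs w ≡ true → InfTail μs w
infTail⇒InfTail μs w e i i<n n∸ℓ≤i with ∨-true (not ((length w ∸ length μs) ≤ᵇ i)) (allBelow-elim e i i<n)
... | inj₁ i<n∸ℓ = ⊥-elim (true≢false (≤⇒≤ᵇ-true n∸ℓ≤i) (not-true i<n∸ℓ))
... | inj₂ isInf  = isInf⇒≡nothing isInf

InfTail⇒infTail : ∀ μs w → InfTail μs w → infTail μs w ≡ true
InfTail⇒infTail μs w h = allBelow-intro test
  where
  test : ∀ i → i < length w → not ((length w ∸ length μs) ≤ᵇ i) ∨ isInf (at w i) ≡ true
  test i i<n with (length w ∸ length μs) ≤ᵇ i in e
  ... | false = refl
  ... | true  rewrite h i i<n (≤ᵇ-true⇒≤ e) = refl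

anchorChecks⇒Anchored : ∀ μs w → allBelow (length w) (λ i → anchorCheck μs w i (at w i)) ≡ true → Anchored μs w
anchorChecks⇒Anchored μs w e i v wᵢ≡v j j<ℓ i+1+j<n with allBelow-elim e i (at-just⇒< w i wᵢ≡v)
... | checkᵢ rewrite wᵢ≡v with ∨-true (not ((i + suc j) <ᵇ length w)) (allK-elim _ μs checkᵢ j j<ℓ)
...   | inj₁ out = ⊥-elim (true≢false (<⇒<ᵇ-true i+1+j<n) (not-true out))
...   | inj₂ ok  = ok

Anchored⇒anchorChecks : ∀ μs w → Anchored μs w → allBelow (length w) (λ i → anchorCheck μs w i (at w i)) ≡ true
Anchored⇒anchorChecks μs w h = allBelow-intro {length w} (λ i _ → check i (at w i) refl)
  where
  check : ∀ i l → at w i ≡ l → anchorCheck μs w i l ≡ true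
  check i nothing  _     = refl
  check i (just v) wᵢ≡v = allK-intro _ μs test
    where
    test : ∀ j → j < length μs → not ((i + suc j) <ᵇ length w) ∨ geL (at w (i + suc j)) (v + nth μs j) ≡ true
    test j j<ℓ with (i + suc j) <ᵇ length w in e
    ... | false = refl
    ... | true  = h i v wᵢ≡v j j<ℓ (<ᵇ-true⇒< e)

linear⇒Linear : ∀ μs w → linear μs w ≡ true → Linear μs w
linear⇒Linear μs w e = anchorChecks⇒Anchored μs w (∧-trueʳ (infTail μs w) e) , infTail⇒InfTail μs w (∧-trueˡ (infTail μs w) e)

Linear⇒linear : ∀ μs w → Linear μs w → linear μs w ≡ true
Linear⇒linear μs w (anchored , tail) = ∧-true (InfTail⇒infTail μs w tail) (Anchored⇒anchorChecks μs w anchored)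

-- The letter test inside anchor is local to its definition and cannot be named, so
-- it is reached only through the value of anchor.
anchor⇒linear : ∀ μs w → anchor μs w ≡ true → (length μs ≤ᵇ length w) ∧ linear μs w ≡ true
anchor⇒linear μs w e =
  ∧-true (∧-trueˡ (length μs ≤ᵇ length w) e)
         (∧-true (∧-trueˡ (infTail μs w) (∧-trueʳ (length μs ≤ᵇ length w) e)) (allBelow-intro check))
  where
  check : ∀ i → i < length w → anchorCheck μs w i (at w i) ≡ true
  check i i<n with at w i | allBelow-elim {length w} (∧-trueʳ (infTail μs w) (∧-trueʳ (length μs ≤ᵇ length w) e)) i i<n
  ... | nothing | _      = refl
  ... | just v  | checkᵢ = checkᵢ

linear⇒anchor : ∀ μs w → (length μs ≤ᵇ length w) ∧ linear μs w ≡ true → anchor μs w ≡ true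
linear⇒anchor μs w e with anchor μs w in e′
... | true  = refl
... | false with ∧-false (length μs ≤ᵇ length w) e′
...   | inj₁ ℓ≰n = ⊥-elim (true≢false (∧-trueˡ (length μs ≤ᵇ length w) e) ℓ≰n)
...   | inj₂ e″ with ∧-false (infTail μs w) e″
...     | inj₁ ¬tail = ⊥-elim (true≢false (∧-trueˡ (infTail μs w) (∧-trueʳ (length μs ≤ᵇ length w) e)) ¬tail)
...     | inj₂ e‴ with allBelow-false {length w} e‴
...       | i , i<n , failᵢ with at w i | failᵢ | allBelow-elim {length w} (∧-trueʳ (infTail μs w) (∧-trueʳ (length μs ≤ᵇ length w) e)) i i<n
...         | just v  | failᵢ′ | checkᵢ = ⊥-elim (true≢false checkᵢ failᵢ′)
...         | nothing | ()     | _

Cylindric : List ℕ → Letter → Word → Set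
Cylindric μs x c = ∀ i v → at (x ∷ c) i ≡ just v → ∀ j → j < length μs →
                   geL (at (x ∷ c) ((i + suc j) % suc (length c))) (v + nth μs j) ≡ true

cylindric⇒Cylindric : ∀ μs x c → cylindric μs (x ∷ c) ≡ true → Cylindric μs x c
cylindric⇒Cylindric μs x c e i v cᵢ≡v j j<ℓ with allBelow-elim {suc (length c)} e i (at-just⇒< (x ∷ c) i cᵢ≡v)
... | checkᵢ rewrite cᵢ≡v = allK-elim _ μs checkᵢ j j<ℓ

Cylindric⇒cylindric : ∀ μs x c → Cylindric μs x c → cylindric μs (x ∷ c) ≡ true
Cylindric⇒cylindric μs x c h with cylindric μs (x ∷ c) in e
... | true  = refl
... | false with allBelow-false {suc (length c)} e
...   | i , _ , failᵢ with at (x ∷ c) i in cᵢ≡l | failᵢ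
...     | just v  | failᵢ′ = ⊥-elim (true≢false (allK-intro _ μs (h i v cᵢ≡l)) failᵢ′)
...     | nothing | ()

InfWindow : List ℕ → Word → ℕ → Set
InfWindow μs u j = ∀ r → r < length μs → at u (j + r) ≡ nothing

FaultFree : List ℕ → Word → Set
FaultFree μs u = u ≡ nothing ∷ []
               ⊎ length μs ≤ length u × Linear μs u × (∃[ v ] at u 0 ≡ just v)
                 × (∀ j → j < length u ∸ length μs → ¬ InfWindow μs u j)

infWindow⇒InfWindow : ∀ μs u j → infWindow u (length μs) j ≡ true → InfWindow μs u j
infWindow⇒InfWindow μs u j e r r<ℓ = isInf⇒≡nothing (allBelow-elim {length μs} e r r<ℓ)

InfWindow⇒infWindow : ∀ μs u j → InfWindow μs u j → infWindow u (length μs) j ≡ true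
InfWindow⇒infWindow μs u j h = allBelow-intro {length μs} (λ r r<ℓ → cong isInf (h r r<ℓ))

NoInnerWindow : List ℕ → Word → Set
NoInnerWindow μs u = allBelow (suc (length u ∸ length μs)) (λ j → (j ≡ᵇ (length u ∸ length μs)) ∨ not (infWindow u (length μs) j)) ≡ true

noInnerWindow⇒ : ∀ μs u → NoInnerWindow μs u → ∀ j → j < length u ∸ length μs → ¬ InfWindow μs u j
noInnerWindow⇒ μs u h j j<n∸ℓ window with ∨-true (j ≡ᵇ (length u ∸ length μs)) (allBelow-elim h j (m<n⇒m<1+n j<n∸ℓ))
... | inj₁ j≡n∸ℓ = <-irrefl (≡ᵇ-true⇒≡ j≡n∸ℓ) j<n∸ℓ
... | inj₂ ¬window = true≢false (InfWindow⇒infWindow μs u j window) (not-true ¬window)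

⇒noInnerWindow : ∀ μs u → (∀ j → j < length u ∸ length μs → ¬ InfWindow μs u j) → NoInnerWindow μs u
⇒noInnerWindow μs u h = allBelow-intro test
  where
  test : ∀ j → j < suc (length u ∸ length μs) → (j ≡ᵇ (length u ∸ length μs)) ∨ not (infWindow u (length μs) j) ≡ true
  test j j<1+n∸ℓ with j ≡ᵇ (length u ∸ length μs) in j≟n∸ℓ
  ... | true  = refl
  ... | false with infWindow u (length μs) j in isWindow
  ...   | false = refl
  ...   | true  = ⊥-elim (h j (≤∧≢⇒< (≤-pred j<1+n∸ℓ) (λ j≡n∸ℓ → true≢false (≡⇒≡ᵇ-true j≡n∸ℓ) j≟n∸ℓ))
                            (infWindow⇒InfWindow μs u j isWindow))

faultFree⇒FaultFree : ∀ μs u → faultFree μs u ≡ true → FaultFree μs u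
faultFree⇒FaultFree μs (nothing ∷ [])    _ = inj₁ refl
faultFree⇒FaultFree μs u@(just v ∷ w)    e =
  inj₂ (≤ᵇ-true⇒≤ (∧-trueˡ (length μs ≤ᵇ length u) anchor′) ,
        linear⇒Linear μs u (∧-trueʳ (length μs ≤ᵇ length u) anchor′) ,
        (v , refl) ,
        noInnerWindow⇒ μs u (∧-trueʳ (anchor μs u) e))
  where
  anchor′ : (length μs ≤ᵇ length u) ∧ linear μs u ≡ true
  anchor′ = anchor⇒linear μs u (∧-trueˡ (anchor μs u) e)
faultFree⇒FaultFree μs []                e = ⊥-elim (true≢false (∧-trueʳ (anchor μs []) e) refl)
faultFree⇒FaultFree μs (nothing ∷ x ∷ w) e = ⊥-elim (true≢false (∧-trueʳ (anchor μs (nothing ∷ x ∷ w)) e) refl)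

FaultFree⇒faultFree : ∀ μs u → FaultFree μs u → faultFree μs u ≡ true
FaultFree⇒faultFree μs .(nothing ∷ []) (inj₁ refl) = refl
FaultFree⇒faultFree μs u@(just v ∷ w) (inj₂ (ℓ≤n , lin , _ , noWindow)) =
  ∧-true (linear⇒anchor μs u (∧-true (≤⇒≤ᵇ-true ℓ≤n) (Linear⇒linear μs u lin))) (⇒noInnerWindow μs u noWindow)
FaultFree⇒faultFree μs (nothing ∷ w) (inj₂ (_ , _ , (v , ()) , _))
FaultFree⇒faultFree μs []            (inj₂ (_ , _ , (v , ()) , _))

-- Factorisation of linear words

module _ (μs : List ℕ) where

  private
    ℓ : ℕ
    ℓ = length μs

  InfBefore : Word → ℕ → Set
  InfBefore y q = ∀ p → p < q → q ≤ p + ℓ → at y p ≡ nothing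

  Fault : Word → ℕ → Set
  Fault y q = 1 ≤ q × InfBefore y q

  FirstFault : Word → ℕ → Set
  FirstFault y i = Fault y i × (∀ q → q < i → ¬ Fault y q)

  factorsAt : Word → ℕ → Bool
  factorsAt y i = faultFree μs (take i y) ∧ linear μs (drop i y)

  InfTail⇒Fault : ∀ y → 1 ≤ length y → InfTail μs y → Fault y (length y)
  InfTail⇒Fault y 1≤n tail = 1≤n , λ p p<n n≤p+ℓ → tail p p<n (≤+⇒∸≤ n≤p+ℓ)

  Fault? : ∀ y q → Dec (Fault y q)
  Fault? y q = 1 ≤? q ×-dec map′ (λ h p → h {p}) (λ h {p} → h p) (allUpTo? (λ p → (q ≤? p + ℓ) →-dec ≟nothing (at y p)) q)

  InfBefore-∞∷ : ∀ w → InfBefore (nothing ∷ w) 1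
  InfBefore-∞∷ w zero    _         _ = refl
  InfBefore-∞∷ w (suc p) (s≤s ()) _

  Linear-[∞] : Linear μs (nothing ∷ [])
  Linear-[∞] = (λ { zero _ () ; (suc _) _ () }) , (λ { zero _ _ → refl ; (suc _) _ _ → refl })

  Linear-++ : ∀ u z → Linear μs u → Linear μs z → Linear μs (u ++ z)
  Linear-++ u z (anchoredᵤ , tailᵤ) (anchored₂ , tail₂) = anchored , tail
    where
    ∣u++z∣ : length (u ++ z) ≡ length u + length z
    ∣u++z∣ = length-++ u {z}
    anchored : Anchored μs (u ++ z)
    anchored p v yₚ≡v j j<ℓ p+1+j<n with position (length u) p
    ... | before p<∣u∣ = subst (λ l → geL l (v + nth μs j) ≡ true) (sym (at-++ˡ u z (p + suc j) inside))
                                (anchoredᵤ p v uₚ≡v j j<ℓ inside)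
      where
      uₚ≡v : at u p ≡ just v
      uₚ≡v = trans (sym (at-++ˡ u z p p<∣u∣)) yₚ≡v
      inside : p + suc j < length u
      inside with p + suc j <? length u
      ... | yes p+1+j<∣u∣ = p+1+j<∣u∣
      ... | no p+1+j≮∣u∣  = ⊥-elim (just≢nothing (trans (sym uₚ≡v)
                              (tailᵤ p p<∣u∣ (≤+⇒∸≤ (≤-trans (≮⇒≥ p+1+j≮∣u∣) (+-monoʳ-≤ p j<ℓ))))))
    ... | after p′ = subst (λ l → geL l (v + nth μs j) ≡ true) (sym (at-++ʳ-+ u z p′ (suc j)))
                           (anchored₂ p′ v (trans (sym (at-++ʳ u z p′)) yₚ≡v) j j<ℓ inside)
      where
      inside : p′ + suc j < length z
      inside = +-cancelˡ-< (length u) (p′ + suc j) (length z)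
                 (subst₂ _<_ (+-assoc (length u) p′ (suc j)) ∣u++z∣ p+1+j<n)
    tail : InfTail μs (u ++ z)
    tail p p<n n∸ℓ≤p with position (length u) p
    ... | before p<∣u∣ = trans (at-++ˡ u z p p<∣u∣) (tailᵤ p p<∣u∣ (≤-trans (∸-monoˡ-≤ ℓ ∣u∣≤n) n∸ℓ≤p))
      where
      ∣u∣≤n : length u ≤ length (u ++ z)
      ∣u∣≤n = ≤-trans (m≤m+n (length u) (length z)) (≤-reflexive (sym ∣u++z∣))
    ... | after p′ = trans (at-++ʳ u z p′)
                           (tail₂ p′ (+-cancelˡ-< (length u) p′ (length z) (subst (length u + p′ <_) ∣u++z∣ p<n))
                                     ([m+n]∸o≤m+p⇒n∸o≤p (length u) {length z} {ℓ} {p′}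
                                        (subst (λ n → n ∸ ℓ ≤ length u + p′) ∣u++z∣ n∸ℓ≤p)))

  Linear-++⁻ : ∀ u z → Linear μs (u ++ z) → InfBefore (u ++ z) (length u) → Linear μs u × Linear μs z
  Linear-++⁻ u z (anchored , tail) infBefore = (anchoredᵤ , tailᵤ) , (anchored₂ , tail₂)
    where
    ∣u++z∣ : length (u ++ z) ≡ length u + length z
    ∣u++z∣ = length-++ u {z}
    anchoredᵤ : Anchored μs u
    anchoredᵤ p v uₚ≡v j j<ℓ p+1+j<∣u∣ =
      subst (λ l → geL l (v + nth μs j) ≡ true) (at-++ˡ u z (p + suc j) p+1+j<∣u∣)
            (anchored p v (trans (at-++ˡ u z p (at-just⇒< u p uₚ≡v)) uₚ≡v) j j<ℓ
                      (≤-trans p+1+j<∣u∣ (≤-trans (m≤m+n (length u) (length z)) (≤-reflexive (sym ∣u++z∣)))))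
    tailᵤ : InfTail μs u
    tailᵤ p p<∣u∣ ∣u∣∸ℓ≤p = trans (sym (at-++ˡ u z p p<∣u∣)) (infBefore p p<∣u∣ (∸≤⇒≤+ ∣u∣∸ℓ≤p))
    anchored₂ : Anchored μs z
    anchored₂ p v zₚ≡v j j<ℓ p+1+j<∣z∣ =
      subst (λ l → geL l (v + nth μs j) ≡ true) (at-++ʳ-+ u z p (suc j))
            (anchored (length u + p) v (trans (at-++ʳ u z p) zₚ≡v) j j<ℓ
                      (subst₂ _<_ (sym (+-assoc (length u) p (suc j))) (sym ∣u++z∣) (+-monoʳ-< (length u) p+1+j<∣z∣)))
    tail₂ : InfTail μs z
    tail₂ p p<∣z∣ ∣z∣∸ℓ≤p =
      trans (sym (at-++ʳ u z p))
            (tail (length u + p) (subst (length u + p <_) (sym ∣u++z∣) (+-monoʳ-< (length u) p<∣z∣))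
                  (subst (λ n → n ∸ ℓ ≤ length u + p) (sym ∣u++z∣) (n∸o≤p⇒[m+n]∸o≤m+p (length u) {length z} {ℓ} ∣z∣∸ℓ≤p)))

  factorisation⇒ : 1 ≤ ℓ → ∀ u z → FaultFree μs u → Linear μs z →
                   Linear μs (u ++ z) × FirstFault (u ++ z) (length u)
  factorisation⇒ _ .(nothing ∷ []) z (inj₁ refl) lin₂ =
    Linear-++ (nothing ∷ []) z Linear-[∞] lin₂ ,
    (≤-refl , InfBefore-∞∷ z) ,
    λ { zero _ (() , _) ; (suc _) (s≤s ()) _ }
  factorisation⇒ ℓ≥1 u z (inj₂ (ℓ≤∣u∣ , linᵤ , (v , u₀≡v) , noWindow)) lin₂ =
    Linear-++ u z linᵤ lin₂ , (≤-trans ℓ≥1 ℓ≤∣u∣ , fault) , minimal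
    where
    fault : InfBefore (u ++ z) (length u)
    fault p p<∣u∣ ∣u∣≤p+ℓ = trans (at-++ˡ u z p p<∣u∣) (proj₂ linᵤ p p<∣u∣ (≤+⇒∸≤ {length u} {ℓ} ∣u∣≤p+ℓ))
    minimal : ∀ q → q < length u → ¬ Fault (u ++ z) q
    minimal q q<∣u∣ (1≤q , infBefore) with q ≤? ℓ
    ... | yes q≤ℓ = just≢nothing (trans (sym (trans (at-++ˡ u z 0 (<-trans 1≤q q<∣u∣)) u₀≡v)) (infBefore 0 1≤q q≤ℓ))
    ... | no q≰ℓ  = noWindow (q ∸ ℓ) (∸-monoˡ-< q<∣u∣ ℓ≤q) window
      where
      ℓ≤q : ℓ ≤ q
      ℓ≤q = <⇒≤ (≰⇒> q≰ℓ)
      q∸ℓ+ℓ≡q : q ∸ ℓ + ℓ ≡ q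
      q∸ℓ+ℓ≡q = m∸n+n≡m ℓ≤q
      window : InfWindow μs u (q ∸ ℓ)
      window r r<ℓ = trans (sym (at-++ˡ u z (q ∸ ℓ + r) (<-trans inside q<∣u∣)))
                           (infBefore (q ∸ ℓ + r) inside (subst (_≤ q ∸ ℓ + r + ℓ) q∸ℓ+ℓ≡q (+-monoˡ-≤ ℓ (m≤m+n (q ∸ ℓ) r))))
        where
        inside : q ∸ ℓ + r < q
        inside = subst (q ∸ ℓ + r <_) q∸ℓ+ℓ≡q (+-monoʳ-< (q ∸ ℓ) r<ℓ)

  FirstFault⇒FaultFree : 1 ≤ ℓ → ∀ u z → Linear μs (u ++ z) → FirstFault (u ++ z) (length u) → FaultFree μs u
  FirstFault⇒FaultFree _ []                z _ ((() , _) , _)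
  FirstFault⇒FaultFree _ (nothing ∷ [])    z _ _ = inj₁ refl
  FirstFault⇒FaultFree _ (nothing ∷ _ ∷ _) z _ (_ , minimal) = ⊥-elim (minimal 1 (s≤s (s≤s z≤n)) (≤-refl , InfBefore-∞∷ _))
  FirstFault⇒FaultFree ℓ≥1 u@(just v ∷ _) z lin ((_ , infBefore) , minimal) =
    inj₂ (ℓ≤∣u∣ , proj₁ (Linear-++⁻ u z lin infBefore) , (v , refl) , noWindow)
    where
    ℓ≤∣u∣ : ℓ ≤ length u
    ℓ≤∣u∣ with ℓ ≤? length u
    ... | yes ℓ≤∣u∣ = ℓ≤∣u∣
    ... | no ℓ≰∣u∣  = ⊥-elim (just≢nothing (infBefore 0 (s≤s z≤n) (<⇒≤ (≰⇒> ℓ≰∣u∣))))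
    noWindow : ∀ j → j < length u ∸ ℓ → ¬ InfWindow μs u j
    noWindow j j<∣u∣∸ℓ window = minimal (j + ℓ) (<∸⇒+< j<∣u∣∸ℓ) (≤-trans ℓ≥1 (m≤n+m ℓ j) , infBeforeJ)
      where
      infBeforeJ : InfBefore (u ++ z) (j + ℓ)
      infBeforeJ p p<j+ℓ j+ℓ≤p+ℓ = trans (at-++ˡ u z p (<-trans p<j+ℓ (<∸⇒+< j<∣u∣∸ℓ)))
                                         (trans (cong (at u) (sym (m+[n∸m]≡n j≤p))) (window (p ∸ j) p∸j<ℓ))
        where
        j≤p : j ≤ p
        j≤p = +-cancelʳ-≤ ℓ j p j+ℓ≤p+ℓ
        p∸j<ℓ : p ∸ j < ℓ
        p∸j<ℓ = +-cancelˡ-< j (p ∸ j) ℓ (subst (_< j + ℓ) (sym (m+[n∸m]≡n j≤p)) p<j+ℓ)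

  factorisation⇐ : 1 ≤ ℓ → ∀ u z → Linear μs (u ++ z) → FirstFault (u ++ z) (length u) →
                   FaultFree μs u × Linear μs z
  factorisation⇐ ℓ≥1 u z lin first =
    FirstFault⇒FaultFree ℓ≥1 u z lin first , proj₂ (Linear-++⁻ u z lin (proj₂ (proj₁ first)))

  factorsAt⇒ : 1 ≤ ℓ → ∀ y i → i ≤ length y → factorsAt y i ≡ true → Linear μs y × FirstFault y i
  factorsAt⇒ ℓ≥1 y i i≤∣y∣ e =
    subst₂ (λ y i → Linear μs y × FirstFault y i) (take++drop≡id i y) (length-take-≤ i y i≤∣y∣)
           (factorisation⇒ ℓ≥1 (take i y) (drop i y) (faultFree⇒FaultFree μs (take i y) (∧-trueˡ (faultFree μs (take i y)) e))
                                                     (linear⇒Linear μs (drop i y) (∧-trueʳ (faultFree μs (take i y)) e)))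

  ⇒factorsAt : 1 ≤ ℓ → ∀ y i → i ≤ length y → Linear μs y → FirstFault y i → factorsAt y i ≡ true
  ⇒factorsAt ℓ≥1 y i i≤∣y∣ lin first =
    ∧-true (FaultFree⇒faultFree μs (take i y) (proj₁ prefix×suffix)) (Linear⇒linear μs (drop i y) (proj₂ prefix×suffix))
    where
    prefix×suffix : FaultFree μs (take i y) × Linear μs (drop i y)
    prefix×suffix = factorisation⇐ ℓ≥1 (take i y) (drop i y) (subst (Linear μs) (sym (take++drop≡id i y)) lin)
                                   (subst₂ FirstFault (sym (take++drop≡id i y)) (sym (length-take-≤ i y i≤∣y∣)) first)

  FirstFault-unique : ∀ y {i i′} → FirstFault y i → FirstFault y i′ → i ≡ i′
  FirstFault-unique y {i} {i′} (fault , minimal) (fault′ , minimal′) with <-cmp i i′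
  ... | tri< i<i′ _ _ = ⊥-elim (minimal′ i i<i′ fault)
  ... | tri≈ _ i≡i′ _ = i≡i′
  ... | tri> _ _ i′<i = ⊥-elim (minimal i′ i′<i fault′)

  FirstFault-exists : ∀ y → 1 ≤ length y → InfTail μs y → ∃[ i ] i ≤ length y × FirstFault y i
  FirstFault-exists y 1≤∣y∣ tail = least (Fault? y) (length y) (InfTail⇒Fault y 1≤∣y∣ tail)

  ∑-factorsAt : 1 ≤ ℓ → ∀ x → 1 ≤ length x → ∑[ i < suc (length x) ] 𝟙 (factorsAt x i) ≡ 𝟙 (linear μs x)
  ∑-factorsAt ℓ≥1 x 1≤∣x∣ with linear μs x in e
  ... | false = ∑<-vanish (suc (length x)) λ i i<1+∣x∣ → 𝟙-≢true λ factors →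
                  true≢false (Linear⇒linear μs x (proj₁ (factorsAt⇒ ℓ≥1 x i (≤-pred i<1+∣x∣) factors))) e
  ... | true with FirstFault-exists x 1≤∣x∣ (proj₂ (linear⇒Linear μs x e))
  ...   | i₀ , i₀≤∣x∣ , first₀ =
    trans (∑<-single (suc (length x)) _ i₀ (s≤s i₀≤∣x∣) others)
          (𝟙-true (⇒factorsAt ℓ≥1 x i₀ i₀≤∣x∣ (linear⇒Linear μs x e) first₀))
    where
    others : ∀ i → i < suc (length x) → i ≢ i₀ → 𝟙 (factorsAt x i) ≡ 0
    others i i<1+∣x∣ i≢i₀ = 𝟙-≢true λ factors →
      i≢i₀ (FirstFault-unique x (proj₂ (factorsAt⇒ ℓ≥1 x i (≤-pred i<1+∣x∣) factors)) first₀)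

-- Rotations of cylindric words

module _ (μs : List ℕ) (x₀ : Letter) (c′ : Word) where

  private
    ℓ : ℕ
    ℓ = length μs
    c : Word
    c = x₀ ∷ c′
    N : ℕ
    N = suc (length c′)

  cyc : ℕ → Letter
  cyc m = at c (m % N)

  cyc-< : ∀ a → a < N → cyc a ≡ at c a
  cyc-< a a<N = cong (at c) (m<n⇒m%n≡m a<N)

  cyc-+N : ∀ a → cyc (a + N) ≡ cyc a
  cyc-+N a = cong (at c) ([m+n]%n≡m%n a N)

  cyc-% : ∀ a b → cyc (a % N + b) ≡ cyc (a + b)
  cyc-% a b = cong (at c) (begin
    (a % N + b) % N           ≡⟨ %-distribˡ-+ (a % N) b N ⟩
    (a % N % N + b % N) % N   ≡⟨ cong (λ r → (r + b % N) % N) (m%n%n≡m%n a N) ⟩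
    (a % N + b % N) % N       ≡⟨ %-distribˡ-+ a b N ⟨
    (a + b) % N               ∎)
    where open ≡-Reasoning

  at-rotate : ∀ s q → s ≤ N → q < N → at (rotate s c) q ≡ cyc (s + q)
  at-rotate s q s≤N q<N with position (length (drop s c)) q
  ... | before q<N∸s = begin
    at (drop s c ++ take s c) q ≡⟨ at-++ˡ (drop s c) (take s c) q q<N∸s ⟩
    at (drop s c) q             ≡⟨ at-drop c s q ⟩
    at c (s + q)                ≡⟨ cyc-< (s + q) (subst (_< N) (+-comm q s) (<∸⇒+< (subst (q <_) (length-drop s c) q<N∸s))) ⟨
    cyc (s + q)                 ∎
    where open ≡-Reasoning
  ... | after q′ = begin
    at (drop s c ++ take s c) (length (drop s c) + q′) ≡⟨ at-++ʳ (drop s c) (take s c) q′ ⟩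
    at (take s c) q′                                   ≡⟨ at-take c s q′ q′<s ⟩
    at c q′                                            ≡⟨ cyc-< q′ (<-≤-trans q′<s s≤N) ⟨
    cyc q′                                             ≡⟨ cyc-+N q′ ⟨
    cyc (q′ + N)                                       ≡⟨ cong cyc q′+N≡s+q ⟩
    cyc (s + (length (drop s c) + q′))                 ∎
    where
    open ≡-Reasoning
    ∣drop∣≡N∸s : length (drop s c) ≡ N ∸ s
    ∣drop∣≡N∸s = length-drop s c
    q′<s : q′ < s
    q′<s = +-cancelˡ-< (N ∸ s) q′ s (subst₂ _<_ (cong (_+ q′) ∣drop∣≡N∸s) (sym (m∸n+n≡m s≤N)) q<N)
    q′+N≡s+q : q′ + N ≡ s + (length (drop s c) + q′)
    q′+N≡s+q = begin
      q′ + N                  ≡⟨ cong (q′ +_) (m+[n∸m]≡n s≤N) ⟨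
      q′ + (s + (N ∸ s))      ≡⟨ x∙yz≈y∙zx q′ s (N ∸ s) ⟩
      s + (N ∸ s + q′)        ≡⟨ cong (λ n → s + (n + q′)) ∣drop∣≡N∸s ⟨
      s + (length (drop s c) + q′) ∎

  CyclicFault : ℕ → Set
  CyclicFault s = ∀ q → q < N → N ∸ ℓ ≤ q → cyc (s + q) ≡ nothing

  CyclicFault? : ∀ s → Dec (CyclicFault s)
  CyclicFault? s = map′ (λ h q → h {q}) (λ h {q} → h q) (allUpTo? (λ q → (N ∸ ℓ ≤? q) →-dec ≟nothing (cyc (s + q))) N)

  rotated-position : ∀ s i → s ≤ N → i < N → ∃[ q ] q < N × (∀ k → cyc (s + q + k) ≡ cyc (i + k))
  rotated-position s i s≤N i<N with s ≤? i
  ... | yes s≤i = i ∸ s , ≤-<-trans (m∸n≤m i s) i<N , λ k → cong (λ n → cyc (n + k)) (m+[n∸m]≡n s≤i)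
  ... | no s≰i  = i + (N ∸ s) , i+N∸s<N , λ k → trans (cong cyc (wraps k)) (cyc-+N (i + k))
    where
    i+N∸s<N : i + (N ∸ s) < N
    i+N∸s<N = subst (i + (N ∸ s) <_) (m∸n+n≡m s≤N) (subst (_< N ∸ s + s) (+-comm (N ∸ s) i) (+-monoʳ-< (N ∸ s) (≰⇒> s≰i)))
    wraps : ∀ k → s + (i + (N ∸ s)) + k ≡ i + k + N
    wraps k = trans (+-wrap s i (N ∸ s) k) (cong (i + k +_) (m+[n∸m]≡n s≤N))

  Linear-rotate⇒Cylindric : ∀ s → s ≤ N → Linear μs (rotate s c) → Cylindric μs x₀ c′
  Linear-rotate⇒Cylindric s s≤N (anchored , tail) i v cᵢ≡v j j<ℓ
    with rotated-position s i s≤N (at-just⇒< c i cᵢ≡v)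
  ... | q , q<N , same = constraint (q + suc j <? N)
    where
    ∣rotate∣ : length (rotate s c) ≡ N
    ∣rotate∣ = length-rotate s c
    at-q≡v : at (rotate s c) q ≡ just v
    at-q≡v = begin
      at (rotate s c) q ≡⟨ at-rotate s q s≤N q<N ⟩
      cyc (s + q)       ≡⟨ cong cyc (+-identityʳ (s + q)) ⟨
      cyc (s + q + 0)   ≡⟨ same 0 ⟩
      cyc (i + 0)       ≡⟨ cong cyc (+-identityʳ i) ⟩
      cyc i             ≡⟨ cyc-< i (at-just⇒< c i cᵢ≡v) ⟩
      at c i            ≡⟨ cᵢ≡v ⟩
      just v            ∎
      where open ≡-Reasoning
    constraint : Dec (q + suc j < N) → geL (cyc (i + suc j)) (v + nth μs j) ≡ true
    constraint (yes q+1+j<N) =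
      subst (λ l → geL l (v + nth μs j) ≡ true)
            (trans (at-rotate s (q + suc j) s≤N q+1+j<N) (trans (cong cyc (sym (+-assoc s q (suc j)))) (same (suc j))))
            (anchored q v at-q≡v j j<ℓ (subst (q + suc j <_) (sym ∣rotate∣) q+1+j<N))
    constraint (no q+1+j≮N) =
      ⊥-elim (just≢nothing (trans (sym at-q≡v)
        (tail q (subst (q <_) (sym ∣rotate∣) q<N)
                (subst (λ n → n ∸ ℓ ≤ q) (sym ∣rotate∣) (≤+⇒∸≤ {N} {ℓ} (≤-trans (≮⇒≥ q+1+j≮N) (+-monoʳ-≤ q j<ℓ)))))))

  Cylindric⇒Linear-rotate : ∀ s → s ≤ N → Cylindric μs x₀ c′ → CyclicFault s → Linear μs (rotate s c)
  Cylindric⇒Linear-rotate s s≤N cyl fault = anchored , tail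
    where
    ∣rotate∣ : length (rotate s c) ≡ N
    ∣rotate∣ = length-rotate s c
    anchored : Anchored μs (rotate s c)
    anchored q v at-q≡v j j<ℓ q+1+j<n =
      subst (λ l → geL l (v + nth μs j) ≡ true) (sym shifted)
            (cyl ((s + q) % N) v (trans (sym (at-rotate s q s≤N q<N)) at-q≡v) j j<ℓ)
      where
      q<N : q < N
      q<N = subst (q <_) ∣rotate∣ (at-just⇒< (rotate s c) q at-q≡v)
      shifted : at (rotate s c) (q + suc j) ≡ cyc ((s + q) % N + suc j)
      shifted = trans (at-rotate s (q + suc j) s≤N (subst (q + suc j <_) ∣rotate∣ q+1+j<n))
                      (trans (cong cyc (sym (+-assoc s q (suc j)))) (sym (cyc-% (s + q) (suc j))))
    tail : InfTail μs (rotate s c)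
    tail q q<n n∸ℓ≤q = trans (at-rotate s q s≤N q<N) (fault q q<N (subst (λ n → n ∸ ℓ ≤ q) ∣rotate∣ n∸ℓ≤q))
      where
      q<N : q < N
      q<N = subst (q <_) ∣rotate∣ q<n

  Linear-rotate⇒CyclicFault : ∀ s → s ≤ N → Linear μs (rotate s c) → CyclicFault s
  Linear-rotate⇒CyclicFault s s≤N (_ , tail) q q<N N∸ℓ≤q =
    trans (sym (at-rotate s q s≤N q<N))
          (tail q (subst (q <_) (sym (length-rotate s c)) q<N) (subst (λ n → n ∸ ℓ ≤ q) (sym (length-rotate s c)) N∸ℓ≤q))

  InfBefore-rotate⇒CyclicFault : ∀ s q → s ≤ N → q ≤ N → CyclicFault s → InfBefore μs (rotate s c) q → CyclicFault (s + q)
  InfBefore-rotate⇒CyclicFault s q s≤N q≤N fault infBefore r r<N N∸ℓ≤r with q + r <? N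
  ... | yes q+r<N = trans (cong cyc (+-assoc s q r)) (fault (q + r) q+r<N (≤-trans N∸ℓ≤r (m≤n+m r q)))
  ... | no q+r≮N  = begin
    cyc (s + q + r)     ≡⟨ cong cyc s+q+r≡s+p+N ⟩
    cyc (s + p + N)     ≡⟨ cyc-+N (s + p) ⟩
    cyc (s + p)         ≡⟨ at-rotate s p s≤N (<-≤-trans p<q q≤N) ⟨
    at (rotate s c) p   ≡⟨ infBefore p p<q q≤p+ℓ ⟩
    nothing             ∎
    where
    open ≡-Reasoning
    p : ℕ
    p = q + r ∸ N
    p+N≡q+r : p + N ≡ q + r
    p+N≡q+r = m∸n+n≡m (≮⇒≥ q+r≮N)
    p<q : p < q
    p<q = +-cancelʳ-< N p q (subst (_< q + N) (sym p+N≡q+r) (+-monoʳ-< q r<N))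
    q≤p+ℓ : q ≤ p + ℓ
    q≤p+ℓ = +-cancelʳ-≤ N q (p + ℓ)
              (≤-trans (+-monoʳ-≤ q (∸≤⇒≤+ {N} {ℓ} N∸ℓ≤r))
                       (≤-reflexive (trans (sym (+-assoc q r ℓ)) (trans (cong (_+ ℓ) (sym p+N≡q+r)) (xy∙z≈xz∙y p N ℓ)))))
    s+q+r≡s+p+N : s + q + r ≡ s + p + N
    s+q+r≡s+p+N = trans (+-assoc s q r) (trans (cong (s +_) (sym p+N≡q+r)) (sym (+-assoc s p N)))

  CyclicFault⇒InfBefore-rotate : ∀ s q → s ≤ N → q ≤ N → CyclicFault (s + q) → InfBefore μs (rotate s c) q
  CyclicFault⇒InfBefore-rotate s q s≤N q≤N fault p p<q q≤p+ℓ = begin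
    at (rotate s c) p ≡⟨ at-rotate s p s≤N (<-≤-trans p<q q≤N) ⟩
    cyc (s + p)       ≡⟨ cyc-+N (s + p) ⟨
    cyc (s + p + N)   ≡⟨ cong cyc s+p+N≡s+q+r ⟩
    cyc (s + q + r)   ≡⟨ fault r r<N N∸ℓ≤r ⟩
    nothing           ∎
    where
    open ≡-Reasoning
    r : ℕ
    r = p + N ∸ q
    r+q≡p+N : r + q ≡ p + N
    r+q≡p+N = m∸n+n≡m (≤-trans q≤N (m≤n+m N p))
    r<N : r < N
    r<N = +-cancelʳ-< q r N (subst₂ _<_ (sym r+q≡p+N) (+-comm q N) (+-monoˡ-< N p<q))
    N∸ℓ≤r : N ∸ ℓ ≤ r
    N∸ℓ≤r = ≤+⇒∸≤ {N} {ℓ} {r} (+-cancelʳ-≤ p N (r + ℓ)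
              (≤-trans (≤-reflexive (trans (+-comm N p) (sym r+q≡p+N)))
                       (≤-trans (+-monoʳ-≤ r q≤p+ℓ) (≤-reflexive (x∙yz≈xz∙y r p ℓ)))))
    s+p+N≡s+q+r : s + p + N ≡ s + q + r
    s+p+N≡s+q+r = trans (+-assoc s p N) (trans (cong (s +_) (trans (sym r+q≡p+N) (+-comm r q))) (sym (+-assoc s q r)))

  -- The ℓ letters following a largest letter would exceed it, so they are ∞.
  Cylindric⇒CyclicFault : All (1 ≤_) μs → Cylindric μs x₀ c′ → ∃[ t ] t ≤ N × CyclicFault t
  Cylindric⇒CyclicFault μs≥1 cyl with maxLetter-attained c
  ... | inj₁ allInf = 0 , z≤n , λ q _ _ → allInf (q % N)
  ... | inj₂ (m , cₘ≡max) = (m + suc ℓ) % N , <⇒≤ (m%n<n (m + suc ℓ) N) , fault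
    where
    fault : CyclicFault ((m + suc ℓ) % N)
    fault q q<N N∸ℓ≤q with cyc ((m + suc ℓ) % N + q) in cyc-t+q≡b
    ... | nothing = refl
    ... | just b  = ⊥-elim (<⇒≱ (m<m+n (maxLetter c) (All-nth μs μs≥1 j j<ℓ))
                               (≤-trans max+μⱼ≤b (maxLetter-upper c (((m + suc ℓ) % N + q) % N) cyc-t+q≡b)))
      where
      j : ℕ
      j = ℓ + q ∸ N
      j+N≡ℓ+q : j + N ≡ ℓ + q
      j+N≡ℓ+q = m∸n+n≡m (subst (N ≤_) (+-comm q ℓ) (∸≤⇒≤+ {N} {ℓ} N∸ℓ≤q))
      j<ℓ : j < ℓ
      j<ℓ = +-cancelʳ-< N j ℓ (subst (_< ℓ + N) (sym j+N≡ℓ+q) (+-monoʳ-< ℓ q<N))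
      cyc-m+1+j≡b : cyc (m + suc j) ≡ just b
      cyc-m+1+j≡b = begin
        cyc (m + suc j)             ≡⟨ cyc-+N (m + suc j) ⟨
        cyc (m + suc j + N)         ≡⟨ cong cyc (+-assoc m (suc j) N) ⟩
        cyc (m + suc (j + N))       ≡⟨ cong (λ n → cyc (m + suc n)) j+N≡ℓ+q ⟩
        cyc (m + (suc ℓ + q))       ≡⟨ cong cyc (+-assoc m (suc ℓ) q) ⟨
        cyc (m + suc ℓ + q)         ≡⟨ cyc-% (m + suc ℓ) q ⟨
        cyc ((m + suc ℓ) % N + q)   ≡⟨ cyc-t+q≡b ⟩
        just b                      ∎
        where open ≡-Reasoning
      max+μⱼ≤b : maxLetter c + nth μs j ≤ b
      max+μⱼ≤b = ≤ᵇ-true⇒≤ (subst (λ l → geL l (maxLetter c + nth μs j) ≡ true) cyc-m+1+j≡b (cyl m (maxLetter c) cₘ≡max j j<ℓ))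

  -- t is the last cyclic fault up to position N ≡ 0 and i* the length of the block
  -- starting there, the block containing position 0.
  module _ (ℓ≥1 : 1 ≤ ℓ) (cyl : Cylindric μs x₀ c′)
           {t : ℕ} (t≤N : t ≤ N) (fault : CyclicFault t) (last : ∀ t′ → t < t′ → t′ ≤ N → ¬ CyclicFault t′)
           {i* : ℕ} (i*≤N : i* ≤ N) (first : FirstFault μs (rotate t c) i*) where

    marked-factorisation-exists : N ∸ t < i* × factorsAt μs (rotate (N ∸ (N ∸ t)) c) i* ≡ true
    marked-factorisation-exists = N∸t<i* , subst (λ s → factorsAt μs (rotate s c) i* ≡ true) (sym (m∸[m∸n]≡n t≤N)) factors
      where
      N∸t<i* : N ∸ t < i*
      N∸t<i* with N ∸ t <? i*
      ... | yes N∸t<i* = N∸t<i*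
      ... | no N∸t≮i*  = ⊥-elim (last (t + i*) (m<m+n t (proj₁ (proj₁ first)))
                              (subst (t + i* ≤_) (m+[n∸m]≡n t≤N) (+-monoʳ-≤ t (≮⇒≥ N∸t≮i*)))
                              (InfBefore-rotate⇒CyclicFault t i* t≤N i*≤N fault (proj₂ (proj₁ first))))
      factors : factorsAt μs (rotate t c) i* ≡ true
      factors = ⇒factorsAt μs ℓ≥1 (rotate t c) i* (subst (i* ≤_) (sym (length-rotate t c)) i*≤N)
                           (Cylindric⇒Linear-rotate t t≤N cyl fault) first

    marked-factorisation-unique : ∀ i p → p < i → i ≤ N → factorsAt μs (rotate (N ∸ p) c) i ≡ true → i ≡ i* × p ≡ N ∸ t
    marked-factorisation-unique i p p<i i≤N factors =
      FirstFault-unique μs (rotate t c) (subst (λ s → FirstFault μs (rotate s c) i) s≡t firstᵢ) first ,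
      trans (sym (m∸[m∸n]≡n p≤N)) (cong (N ∸_) s≡t)
      where
      s : ℕ
      s = N ∸ p
      p≤N : p ≤ N
      p≤N = <⇒≤ (<-≤-trans p<i i≤N)
      linᵢ×firstᵢ : Linear μs (rotate s c) × FirstFault μs (rotate s c) i
      linᵢ×firstᵢ = factorsAt⇒ μs ℓ≥1 (rotate s c) i (subst (i ≤_) (sym (length-rotate s c)) i≤N) factors
      firstᵢ : FirstFault μs (rotate s c) i
      firstᵢ = proj₂ linᵢ×firstᵢ
      s≤t : s ≤ t
      s≤t with s ≤? t
      ... | yes s≤t = s≤t
      ... | no s≰t  = ⊥-elim (last s (≰⇒> s≰t) (m∸n≤m N p) (Linear-rotate⇒CyclicFault s (m∸n≤m N p) (proj₁ linᵢ×firstᵢ)))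
      s≡t : s ≡ t
      s≡t with m≤n⇒m<n∨m≡n s≤t
      ... | inj₂ s≡t = s≡t
      ... | inj₁ s<t = ⊥-elim (proj₂ firstᵢ (t ∸ s) (≤-<-trans t∸s≤p p<i) (m<n⇒0<n∸m s<t , infBefore))
        where
        t∸s≤p : t ∸ s ≤ p
        t∸s≤p = subst (t ∸ s ≤_) (m∸[m∸n]≡n p≤N) (∸-monoˡ-≤ s t≤N)
        infBefore : InfBefore μs (rotate s c) (t ∸ s)
        infBefore = CyclicFault⇒InfBefore-rotate s (t ∸ s) (m∸n≤m N p) (≤-trans t∸s≤p p≤N)
                      (subst CyclicFault (sym (m+[n∸m]≡n s≤t)) fault)

    ∑-marked-factorisations≡1 : ∑[ i < suc N ] ∑[ p < i ] 𝟙 (factorsAt μs (rotate (N ∸ p) c) i) ≡ 1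
    ∑-marked-factorisations≡1 = begin
      ∑[ i < suc N ] ∑[ p < i ] 𝟙 (factorsAt μs (rotate (N ∸ p) c) i)  ≡⟨ ∑<-single (suc N) _ i* (s≤s i*≤N) otherᵢ ⟩
      ∑[ p < i* ] 𝟙 (factorsAt μs (rotate (N ∸ p) c) i*)              ≡⟨ ∑<-single i* _ (N ∸ t) (proj₁ marked-factorisation-exists) otherₚ ⟩
      𝟙 (factorsAt μs (rotate (N ∸ (N ∸ t)) c) i*)                     ≡⟨ 𝟙-true (proj₂ marked-factorisation-exists) ⟩
      1                                                                ∎
      where
      open ≡-Reasoning
      otherᵢ : ∀ i → i < suc N → i ≢ i* → ∑[ p < i ] 𝟙 (factorsAt μs (rotate (N ∸ p) c) i) ≡ 0
      otherᵢ i i<1+N i≢i* = ∑<-vanish i λ p p<i → 𝟙-≢true λ factors →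
        i≢i* (proj₁ (marked-factorisation-unique i p p<i (≤-pred i<1+N) factors))
      otherₚ : ∀ p → p < i* → p ≢ N ∸ t → 𝟙 (factorsAt μs (rotate (N ∸ p) c) i*) ≡ 0
      otherₚ p p<i* p≢N∸t = 𝟙-≢true λ factors → p≢N∸t (proj₂ (marked-factorisation-unique i* p p<i* i*≤N factors))

  factorsAt-rotate⇒Cylindric : 1 ≤ ℓ → ∀ i p → i ≤ N → factorsAt μs (rotate (N ∸ p) c) i ≡ true → Cylindric μs x₀ c′
  factorsAt-rotate⇒Cylindric ℓ≥1 i p i≤N factors =
    Linear-rotate⇒Cylindric (N ∸ p) (m∸n≤m N p)
      (proj₁ (factorsAt⇒ μs ℓ≥1 (rotate (N ∸ p) c) i (subst (i ≤_) (sym (length-rotate (N ∸ p) c)) i≤N) factors))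

  ∑-marked-factorisations : 1 ≤ ℓ → All (1 ≤_) μs →
                            ∑[ i < suc N ] ∑[ p < i ] 𝟙 (factorsAt μs (rotate (N ∸ p) c) i) ≡ 𝟙 (cylindric μs c)
  ∑-marked-factorisations ℓ≥1 μs≥1 with cylindric μs c in e
  ... | false = ∑<-vanish (suc N) λ i i<1+N → ∑<-vanish i λ p _ → 𝟙-≢true λ factors →
    true≢false (Cylindric⇒cylindric μs x₀ c′ (factorsAt-rotate⇒Cylindric ℓ≥1 i p (≤-pred i<1+N) factors)) e
  ... | true with cylindric⇒Cylindric μs x₀ c′ e
  ...   | cyl with Cylindric⇒CyclicFault μs≥1 cyl
  ...     | t₀ , t₀≤N , fault₀ with greatest CyclicFault? N t₀≤N fault₀
  ...       | t , t≤N , fault , last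
              with FirstFault-exists μs (rotate t c) (subst (1 ≤_) (sym (length-rotate t c)) (s≤s z≤n))
                                     (proj₂ (Cylindric⇒Linear-rotate t t≤N cyl fault))
  ...         | i* , i*≤n , first =
    ∑-marked-factorisations≡1 ℓ≥1 cyl t≤N fault last (subst (i* ≤_) (length-rotate t c) i*≤n) first

-- Power series

⊛-unfold : ∀ F G n k → (F ⊛ G) n k ≡ ∑[ i < suc n ] ∑[ j < suc k ] F i j * G (n ∸ i) (k ∸ j)
⊛-unfold F G n k = trans (sum-map-upTo (suc n) _) (∑<-cong (suc n) λ i _ → sum-map-upTo (suc k) _)

≡ᵇ-cancelˡ : ∀ a b c → (a + b ≡ᵇ a + c) ≡ (b ≡ᵇ c)
≡ᵇ-cancelˡ zero    b c = refl
≡ᵇ-cancelˡ (suc a) b c = ≡ᵇ-cancelˡ a b c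

∑-𝟙≡ᵇ-split : ∀ a b k → ∑[ j < suc k ] 𝟙 (a ≡ᵇ j) * 𝟙 (b ≡ᵇ (k ∸ j)) ≡ 𝟙 ((a + b) ≡ᵇ k)
∑-𝟙≡ᵇ-split a b k with a ≤? k
... | yes a≤k = begin
  ∑[ j < suc k ] 𝟙 (a ≡ᵇ j) * 𝟙 (b ≡ᵇ (k ∸ j)) ≡⟨ ∑<-single (suc k) _ a (s≤s a≤k) others ⟩
  𝟙 (a ≡ᵇ a) * 𝟙 (b ≡ᵇ (k ∸ a))                 ≡⟨ cong (λ x → 𝟙 x * 𝟙 (b ≡ᵇ (k ∸ a))) (≡⇒≡ᵇ-true {a} refl) ⟩
  𝟙 (b ≡ᵇ (k ∸ a)) + 0                           ≡⟨ +-identityʳ _ ⟩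
  𝟙 (b ≡ᵇ (k ∸ a))                               ≡⟨ cong 𝟙 (≡ᵇ-cancelˡ a b (k ∸ a)) ⟨
  𝟙 ((a + b) ≡ᵇ (a + (k ∸ a)))                   ≡⟨ cong (λ n → 𝟙 ((a + b) ≡ᵇ n)) (m+[n∸m]≡n a≤k) ⟩
  𝟙 ((a + b) ≡ᵇ k)                               ∎
  where
  open ≡-Reasoning
  others : ∀ j → j < suc k → j ≢ a → 𝟙 (a ≡ᵇ j) * 𝟙 (b ≡ᵇ (k ∸ j)) ≡ 0
  others j _ j≢a = cong (_* 𝟙 (b ≡ᵇ (k ∸ j))) (𝟙-≢true λ a≡j → j≢a (sym (≡ᵇ-true⇒≡ a≡j)))
... | no a≰k = trans (∑<-vanish (suc k) vanish)
                     (sym (𝟙-≢true λ a+b≡k → a≰k (≤-trans (m≤m+n a b) (≤-reflexive (≡ᵇ-true⇒≡ a+b≡k)))))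
  where
  vanish : ∀ j → j < suc k → 𝟙 (a ≡ᵇ j) * 𝟙 (b ≡ᵇ (k ∸ j)) ≡ 0
  vanish j j<1+k = cong (_* 𝟙 (b ≡ᵇ (k ∸ j))) (𝟙-≢true λ a≡j → a≰k (subst (_≤ k) (sym (≡ᵇ-true⇒≡ a≡j)) (≤-pred j<1+k)))

∑∈-*-∑∈ : {A B : Set} (xs : List A) (ys : List B) (f : A → ℕ) (g : B → ℕ) →
          ∑∈ xs f * ∑∈ ys g ≡ ∑[ x ∈ xs ] ∑[ y ∈ ys ] f x * g y
∑∈-*-∑∈ xs ys f g = trans (∑∈-*ʳ (∑∈ ys g) xs f) (∑∈-cong xs λ x → ∑∈-*ˡ (f x) ys g)

∑-bigtiles-split : ∀ (P Q : Word → Bool) u v k →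
  ∑[ j < suc k ] (𝟙 (P u) * 𝟙 (bigtiles u ≡ᵇ j)) * (𝟙 (Q v) * 𝟙 (bigtiles v ≡ᵇ (k ∸ j)))
  ≡ 𝟙 (P u ∧ Q v) * 𝟙 (bigtiles (u ++ v) ≡ᵇ k)
∑-bigtiles-split P Q u v k = begin
  ∑[ j < suc k ] (𝟙 (P u) * 𝟙 (bigtiles u ≡ᵇ j)) * (𝟙 (Q v) * 𝟙 (bigtiles v ≡ᵇ (k ∸ j)))
    ≡⟨ ∑<-cong (suc k) (λ j _ → *-interchange (𝟙 (P u)) (𝟙 (bigtiles u ≡ᵇ j)) (𝟙 (Q v)) _) ⟩
  ∑[ j < suc k ] (𝟙 (P u) * 𝟙 (Q v)) * (𝟙 (bigtiles u ≡ᵇ j) * 𝟙 (bigtiles v ≡ᵇ (k ∸ j)))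
    ≡⟨ ∑<-*ˡ (𝟙 (P u) * 𝟙 (Q v)) (suc k) _ ⟨
  (𝟙 (P u) * 𝟙 (Q v)) * (∑[ j < suc k ] 𝟙 (bigtiles u ≡ᵇ j) * 𝟙 (bigtiles v ≡ᵇ (k ∸ j)))
    ≡⟨ cong₂ _*_ (sym (𝟙-∧ (P u) (Q v))) (∑-𝟙≡ᵇ-split (bigtiles u) (bigtiles v) k) ⟩
  𝟙 (P u ∧ Q v) * 𝟙 ((bigtiles u + bigtiles v) ≡ᵇ k)
    ≡⟨ cong (λ b → 𝟙 (P u ∧ Q v) * 𝟙 (b ≡ᵇ k)) (bigtiles-++ u v) ⟨
  𝟙 (P u ∧ Q v) * 𝟙 (bigtiles (u ++ v) ≡ᵇ k)
    ∎
  where open ≡-Reasoning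

wordSeries-convolution : ∀ (P Q : Word → Bool) d n i k → i ≤ n →
  ∑[ j < suc k ] wordSeries P d i j * wordSeries Q d (n ∸ i) (k ∸ j)
  ≡ ∑[ w ∈ words d n ] 𝟙 (P (take i w) ∧ Q (drop i w)) * 𝟙 (bigtiles w ≡ᵇ k)
wordSeries-convolution P Q d n i k i≤n = begin
  ∑[ j < suc k ] wordSeries P d i j * wordSeries Q d (n ∸ i) (k ∸ j)
    ≡⟨ ∑<-cong (suc k) (λ j _ → ∑∈-*-∑∈ (words d i) (words d (n ∸ i)) _ _) ⟩
  ∑[ j < suc k ] ∑[ u ∈ words d i ] ∑[ v ∈ words d (n ∸ i) ] term u v j
    ≡⟨ trans (∑<-∑∈-comm (suc k) (words d i) _) (∑∈-cong (words d i) λ u → ∑<-∑∈-comm (suc k) (words d (n ∸ i)) _) ⟩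
  ∑[ u ∈ words d i ] ∑[ v ∈ words d (n ∸ i) ] ∑[ j < suc k ] term u v j
    ≡⟨ ∑-words-cong d i (λ u ∣u∣≡i → ∑∈-cong (words d (n ∸ i)) λ v → trans (∑-bigtiles-split P Q u v k) (split u v ∣u∣≡i)) ⟩
  ∑[ u ∈ words d i ] ∑[ v ∈ words d (n ∸ i) ] summand (u ++ v)
    ≡⟨ ∑-words-++ d i (n ∸ i) summand ⟨
  ∑[ w ∈ words d (i + (n ∸ i)) ] summand w
    ≡⟨ cong (λ m → ∑[ w ∈ words d m ] summand w) (m+[n∸m]≡n i≤n) ⟩
  ∑[ w ∈ words d n ] summand w
    ∎
  where
  open ≡-Reasoning
  term : Word → Word → ℕ → ℕ
  term u v j = (𝟙 (P u) * 𝟙 (bigtiles u ≡ᵇ j)) * (𝟙 (Q v) * 𝟙 (bigtiles v ≡ᵇ (k ∸ j)))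
  summand : Word → ℕ
  summand w = 𝟙 (P (take i w) ∧ Q (drop i w)) * 𝟙 (bigtiles w ≡ᵇ k)
  split : ∀ u v → length u ≡ i → 𝟙 (P u ∧ Q v) * 𝟙 (bigtiles (u ++ v) ≡ᵇ k) ≡ summand (u ++ v)
  split u v refl = cong₂ (λ x y → 𝟙 (P x ∧ Q y) * 𝟙 (bigtiles (u ++ v) ≡ᵇ k)) (sym (take-length-++ u v)) (sym (drop-length-++ u v))

⊛-congʳ : ∀ F {G H : Series} → (∀ m k → G m k ≡ H m k) → ∀ n k → (F ⊛ G) n k ≡ (F ⊛ H) n k
⊛-congʳ F {G} {H} G≡H n k = begin
  (F ⊛ G) n k                                              ≡⟨ ⊛-unfold F G n k ⟩
  ∑[ i < suc n ] ∑[ j < suc k ] F i j * G (n ∸ i) (k ∸ j)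
    ≡⟨ ∑<-cong (suc n) (λ i _ → ∑<-cong (suc k) λ j _ → cong (F i j *_) (G≡H (n ∸ i) (k ∸ j))) ⟩
  ∑[ i < suc n ] ∑[ j < suc k ] F i j * H (n ∸ i) (k ∸ j)  ≡⟨ ⊛-unfold F H n k ⟨
  (F ⊛ H) n k                                              ∎
  where open ≡-Reasoning

xD-⊛-zero : ∀ F G k → (xD F ⊛ G) 0 k ≡ 0
xD-⊛-zero F G k = trans (⊛-unfold (xD F) G 0 k) (∑<-vanish (suc k) λ _ _ → refl)

module _ (B : Series) (B₀≡0 : ∀ j → B 0 j ≡ 0) where

  ⊛-cong-below : ∀ {X Y : Series} n k → (∀ m k′ → m < n → X m k′ ≡ Y m k′) → (B ⊛ X) n k ≡ (B ⊛ Y) n k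
  ⊛-cong-below {X} {Y} n k X≡Y = begin
    (B ⊛ X) n k                                              ≡⟨ ⊛-unfold B X n k ⟩
    ∑[ i < suc n ] ∑[ j < suc k ] B i j * X (n ∸ i) (k ∸ j)  ≡⟨ ∑<-cong (suc n) (λ i i<1+n → ∑<-cong (suc k) (λ j _ → term i j i<1+n)) ⟩
    ∑[ i < suc n ] ∑[ j < suc k ] B i j * Y (n ∸ i) (k ∸ j)  ≡⟨ ⊛-unfold B Y n k ⟨
    (B ⊛ Y) n k                                              ∎
    where
    open ≡-Reasoning
    term : ∀ i j → i < suc n → B i j * X (n ∸ i) (k ∸ j) ≡ B i j * Y (n ∸ i) (k ∸ j)
    term zero    j _         rewrite B₀≡0 j = refl
    term (suc i) j (s≤s i<n) = cong (B (suc i) j *_) (X≡Y (n ∸ suc i) (k ∸ j) (∸-monoʳ-< {n} {suc i} {0} (s≤s z≤n) i<n))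

  fixpoint-unique : ∀ {X Y : Series} → (∀ m k → X m k ≡ oneS m k + (B ⊛ X) m k) →
                    (∀ m k → Y m k ≡ oneS m k + (B ⊛ Y) m k) → ∀ m k → X m k ≡ Y m k
  fixpoint-unique {X} {Y} X-fix Y-fix = <-rec (λ m → ∀ k → X m k ≡ Y m k) step
    where
    step : ∀ m → (∀ {m′} → m′ < m → ∀ k → X m′ k ≡ Y m′ k) → ∀ k → X m k ≡ Y m k
    step m below k = begin
      X m k                     ≡⟨ X-fix m k ⟩
      oneS m k + (B ⊛ X) m k    ≡⟨ cong (oneS m k +_) (⊛-cong-below m k λ m′ k′ m′<m → below m′<m k′) ⟩
      oneS m k + (B ⊛ Y) m k    ≡⟨ Y-fix m k ⟨
      Y m k                     ∎
      where open ≡-Reasoning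

  powS-vanish : ∀ p m k → m < p → powS B p m k ≡ 0
  powS-vanish (suc p) m k m<1+p = begin
    (B ⊛ powS B p) m k                                               ≡⟨ ⊛-unfold B (powS B p) m k ⟩
    ∑[ i < suc m ] ∑[ j < suc k ] B i j * powS B p (m ∸ i) (k ∸ j)   ≡⟨ ∑<-vanish (suc m) (λ i i<1+m → ∑<-vanish (suc k) (λ j _ → term i j i<1+m)) ⟩
    0                                                                ∎
    where
    open ≡-Reasoning
    term : ∀ i j → i < suc m → B i j * powS B p (m ∸ i) (k ∸ j) ≡ 0
    term zero    j _         rewrite B₀≡0 j = refl
    term (suc i) j (s≤s i<m) = trans (cong (B (suc i) j *_) (powS-vanish p (m ∸ suc i) (k ∸ j) m∸1+i<p)) (*-zeroʳ (B (suc i) j))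
      where
      m∸1+i<p : m ∸ suc i < p
      m∸1+i<p = <-≤-trans (∸-monoʳ-< {m} {suc i} {0} (s≤s z≤n) i<m) (≤-pred m<1+p)

  ∑-powS≡geomS : ∀ M n k → n < M → ∑[ p < M ] powS B p n k ≡ geomS B n k
  ∑-powS≡geomS M n k n<M =
    trans (∑<-truncate (suc n) M _ n<M (λ p n<p _ → powS-vanish p n k n<p)) (sym (sum-map-upTo (suc n) _))

  geomS-fixpoint : ∀ m k → geomS B m k ≡ oneS m k + (B ⊛ geomS B) m k
  geomS-fixpoint m k = begin
    geomS B m k                                                        ≡⟨ ∑-powS≡geomS (suc m) m k ≤-refl ⟨
    ∑[ p < suc m ] powS B p m k                                        ≡⟨ ∑<-sucˡ m (λ p → powS B p m k) ⟩
    oneS m k + (∑[ p < m ] (B ⊛ powS B p) m k)                         ≡⟨ cong (oneS m k +_) ∑-⊛-powS ⟩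
    oneS m k + (B ⊛ geomS B) m k                                       ∎
    where
    open ≡-Reasoning
    term : ∀ i j → i < suc m → B i j * (∑[ p < m ] powS B p (m ∸ i) (k ∸ j)) ≡ B i j * geomS B (m ∸ i) (k ∸ j)
    term zero    j _         rewrite B₀≡0 j = refl
    term (suc i) j (s≤s i<m) = cong (B (suc i) j *_) (∑-powS≡geomS m (m ∸ suc i) (k ∸ j) (∸-monoʳ-< {m} {suc i} {0} (s≤s z≤n) i<m))
    ∑-⊛-powS : ∑[ p < m ] (B ⊛ powS B p) m k ≡ (B ⊛ geomS B) m k
    ∑-⊛-powS = begin
      ∑[ p < m ] (B ⊛ powS B p) m k                                              ≡⟨ ∑<-cong m (λ p _ → ⊛-unfold B (powS B p) m k) ⟩
      ∑[ p < m ] ∑[ i < suc m ] ∑[ j < suc k ] B i j * powS B p (m ∸ i) (k ∸ j)  ≡⟨ ∑<-comm m (suc m) _ ⟩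
      ∑[ i < suc m ] ∑[ p < m ] ∑[ j < suc k ] B i j * powS B p (m ∸ i) (k ∸ j)  ≡⟨ ∑<-cong (suc m) (λ i _ → ∑<-comm m (suc k) _) ⟩
      ∑[ i < suc m ] ∑[ j < suc k ] ∑[ p < m ] B i j * powS B p (m ∸ i) (k ∸ j)  ≡⟨ ∑<-cong (suc m) (λ i i<1+m → ∑<-cong (suc k) (λ j _ →
                                                                                      trans (sym (∑<-*ˡ (B i j) m _)) (term i j i<1+m))) ⟩
      ∑[ i < suc m ] ∑[ j < suc k ] B i j * geomS B (m ∸ i) (k ∸ j)              ≡⟨ ⊛-unfold B (geomS B) m k ⟨
      (B ⊛ geomS B) m k                                                          ∎

  ⊛-zero : ∀ X k → (B ⊛ X) 0 k ≡ 0
  ⊛-zero X k = trans (⊛-unfold B X 0 k) (∑<-vanish (suc k) λ j _ → cong (_* X 0 (k ∸ j)) (B₀≡0 j))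

-- Counting words

¬faultFree-[] : ∀ μs → faultFree μs [] ≢ true
¬faultFree-[] μs e with faultFree⇒FaultFree μs [] e
... | inj₂ (_ , _ , (_ , ()) , _)

Bser≡wordSeries : ∀ μs d n k → Bser μs d n k ≡ wordSeries (faultFree μs) d n k
Bser≡wordSeries μs d = count≡wordSeries (faultFree μs) d

Bser-zero : ∀ μs d k → Bser μs d 0 k ≡ 0
Bser-zero μs d k = trans (Bser≡wordSeries μs d 0 k) (cong (λ x → x * 𝟙 (0 ≡ᵇ k) + 0) (𝟙-≢true (¬faultFree-[] μs)))

linearSeries : List ℕ → ℕ → Series
linearSeries μs = wordSeries (linear μs)

module _ (μs : List ℕ) (d : ℕ) (ℓ≥1 : 1 ≤ length μs) where

  private
    B : Series
    B = Bser μs d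
    L : Series
    L = linearSeries μs d

  convolution-factorsAt : ∀ n i k → i ≤ n →
    ∑[ j < suc k ] B i j * L (n ∸ i) (k ∸ j) ≡ ∑[ w ∈ words d n ] 𝟙 (factorsAt μs w i) * 𝟙 (bigtiles w ≡ᵇ k)
  convolution-factorsAt n i k i≤n =
    trans (∑<-cong (suc k) (λ j _ → cong (_* L (n ∸ i) (k ∸ j)) (Bser≡wordSeries μs d i j)))
          (wordSeries-convolution (faultFree μs) (linear μs) d n i k i≤n)

  linearSeries-fixpoint : ∀ m k → L m k ≡ oneS m k + (B ⊛ L) m k
  linearSeries-fixpoint zero zero    = sym (cong suc (⊛-zero B (Bser-zero μs d) L 0))
  linearSeries-fixpoint zero (suc k) = sym (⊛-zero B (Bser-zero μs d) L (suc k))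
  linearSeries-fixpoint (suc m) k = sym (begin
    (B ⊛ L) (suc m) k
      ≡⟨ ⊛-unfold B L (suc m) k ⟩
    ∑[ i < suc (suc m) ] ∑[ j < suc k ] B i j * L (suc m ∸ i) (k ∸ j)
      ≡⟨ ∑<-cong (suc (suc m)) (λ i i<2+m → convolution-factorsAt (suc m) i k (≤-pred i<2+m)) ⟩
    ∑[ i < suc (suc m) ] ∑[ w ∈ words d (suc m) ] 𝟙 (factorsAt μs w i) * 𝟙 (bigtiles w ≡ᵇ k)
      ≡⟨ ∑<-∑∈-comm (suc (suc m)) (words d (suc m)) _ ⟩
    ∑[ w ∈ words d (suc m) ] ∑[ i < suc (suc m) ] 𝟙 (factorsAt μs w i) * 𝟙 (bigtiles w ≡ᵇ k)
      ≡⟨ ∑∈-cong (words d (suc m)) (λ w → ∑<-*ʳ (𝟙 (bigtiles w ≡ᵇ k)) (suc (suc m)) _) ⟨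
    ∑[ w ∈ words d (suc m) ] (∑[ i < suc (suc m) ] 𝟙 (factorsAt μs w i)) * 𝟙 (bigtiles w ≡ᵇ k)
      ≡⟨ ∑-words-cong d (suc m) (λ w ∣w∣≡1+m → cong (_* 𝟙 (bigtiles w ≡ᵇ k))
            (subst (λ n → ∑[ i < suc n ] 𝟙 (factorsAt μs w i) ≡ 𝟙 (linear μs w)) ∣w∣≡1+m
                   (∑-factorsAt μs ℓ≥1 w (subst (1 ≤_) (sym ∣w∣≡1+m) (s≤s z≤n))))) ⟩
    L (suc m) k
      ∎)
    where open ≡-Reasoning

  geomS≡linearSeries : ∀ m k → geomS B m k ≡ L m k
  geomS≡linearSeries = fixpoint-unique B (Bser-zero μs d) (geomS-fixpoint B (Bser-zero μs d)) linearSeries-fixpoint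

  xD-Bser⊛linearSeries : ∀ n k → (xD B ⊛ L) n k ≡
    ∑[ i < suc n ] ∑[ p < i ] ∑[ c ∈ words d n ] 𝟙 (factorsAt μs (rotate (n ∸ p) c) i) * 𝟙 (bigtiles c ≡ᵇ k)
  xD-Bser⊛linearSeries n k = begin
    (xD B ⊛ L) n k
      ≡⟨ ⊛-unfold (xD B) L n k ⟩
    ∑[ i < suc n ] ∑[ j < suc k ] (i * B i j) * L (n ∸ i) (k ∸ j)
      ≡⟨ ∑<-cong (suc n) (λ i i<1+n → begin
           ∑[ j < suc k ] (i * B i j) * L (n ∸ i) (k ∸ j)  ≡⟨ ∑<-cong (suc k) (λ j _ → *-assoc i (B i j) _) ⟩
           ∑[ j < suc k ] i * (B i j * L (n ∸ i) (k ∸ j))  ≡⟨ ∑<-*ˡ i (suc k) _ ⟨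
           i * (∑[ j < suc k ] B i j * L (n ∸ i) (k ∸ j))  ≡⟨ cong (i *_) (convolution-factorsAt n i k (≤-pred i<1+n)) ⟩
           i * (∑[ w ∈ words d n ] 𝟙 (factorsAt μs w i) * 𝟙 (bigtiles w ≡ᵇ k)) ≡⟨ ∑<-const i _ ⟨
           ∑[ p < i ] ∑[ w ∈ words d n ] 𝟙 (factorsAt μs w i) * 𝟙 (bigtiles w ≡ᵇ k) ∎) ⟩
    ∑[ i < suc n ] ∑[ p < i ] ∑[ w ∈ words d n ] 𝟙 (factorsAt μs w i) * 𝟙 (bigtiles w ≡ᵇ k)
      ≡⟨ ∑<-cong (suc n) (λ i _ → ∑<-cong i λ p _ → rotated i p) ⟩
    ∑[ i < suc n ] ∑[ p < i ] ∑[ c ∈ words d n ] 𝟙 (factorsAt μs (rotate (n ∸ p) c) i) * 𝟙 (bigtiles c ≡ᵇ k)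
      ∎
    where
    open ≡-Reasoning
    rotated : ∀ i p → ∑[ w ∈ words d n ] 𝟙 (factorsAt μs w i) * 𝟙 (bigtiles w ≡ᵇ k)
                      ≡ ∑[ c ∈ words d n ] 𝟙 (factorsAt μs (rotate (n ∸ p) c) i) * 𝟙 (bigtiles c ≡ᵇ k)
    rotated i p = trans (∑-words-rotate d n (n ∸ p) _ (m∸n≤m n p))
                        (∑∈-cong (words d n) λ c →
                           cong (λ b → 𝟙 (factorsAt μs (rotate (n ∸ p) c) i) * 𝟙 (b ≡ᵇ k)) (bigtiles-rotate (n ∸ p) c))

  ∑-marked-factorisations-words : All (1 ≤_) μs → ∀ N k →
    ∑[ i < suc (suc N) ] ∑[ p < i ] ∑[ c ∈ words d (suc N) ] 𝟙 (factorsAt μs (rotate (suc N ∸ p) c) i) * 𝟙 (bigtiles c ≡ᵇ k)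
    ≡ wordSeries (cylindric μs) d (suc N) k
  ∑-marked-factorisations-words μs≥1 N k = begin
    ∑[ i < suc n ] ∑[ p < i ] ∑[ c ∈ words d n ] marked c i p * δ c
      ≡⟨ ∑<-cong (suc n) (λ i _ → ∑<-∑∈-comm i (words d n) _) ⟩
    ∑[ i < suc n ] ∑[ c ∈ words d n ] ∑[ p < i ] marked c i p * δ c
      ≡⟨ ∑<-∑∈-comm (suc n) (words d n) _ ⟩
    ∑[ c ∈ words d n ] ∑[ i < suc n ] ∑[ p < i ] marked c i p * δ c
      ≡⟨ ∑∈-cong (words d n) (λ c → trans (∑<-cong (suc n) (λ i _ → sym (∑<-*ʳ (δ c) i _))) (sym (∑<-*ʳ (δ c) (suc n) _))) ⟩
    ∑[ c ∈ words d n ] (∑[ i < suc n ] ∑[ p < i ] marked c i p) * δ c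
      ≡⟨ ∑-words-cong d n (λ c ∣c∣≡n → cong (_* δ c) (∑-marked N c ∣c∣≡n)) ⟩
    ∑[ c ∈ words d n ] 𝟙 (cylindric μs c) * δ c
      ∎
    where
    open ≡-Reasoning
    n : ℕ
    n = suc N
    marked : Word → ℕ → ℕ → ℕ
    marked c i p = 𝟙 (factorsAt μs (rotate (n ∸ p) c) i)
    δ : Word → ℕ
    δ c = 𝟙 (bigtiles c ≡ᵇ k)
    ∑-marked : ∀ M c → length c ≡ suc M →
               ∑[ i < suc (suc M) ] ∑[ p < i ] 𝟙 (factorsAt μs (rotate (suc M ∸ p) c) i) ≡ 𝟙 (cylindric μs c)
    ∑-marked .(length c′) (x₀ ∷ c′) refl = ∑-marked-factorisations μs x₀ c′ ℓ≥1 μs≥1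

theorem6p2 : (μ₀ : ℕ) (μs : List ℕ) (d : ℕ) →
    1 ≤ length μs → Linked _≥_ (μ₀ ∷ μs) → All (1 ≤_) μs →
    1 ≤ d → d ≤ μ₀ →
    (n k : ℕ) →
    Cser μs d n k ≡ (oneS ⊕ (xD (Bser μs d) ⊛ geomS (Bser μs d))) n k
-- The hypotheses on μ₀ and d are needed only for the tiling interpretation.
theorem6p2 _ μs d _ _ _ _ _ zero k =
  sym (trans (cong (oneS 0 k +_) (xD-⊛-zero (Bser μs d) (geomS (Bser μs d)) k)) (+-identityʳ (oneS 0 k)))
theorem6p2 _ μs d ℓ≥1 _ μs≥1 _ _ (suc N) k = begin
  Cser μs d (suc N) k
    ≡⟨ count≡wordSeries (cylindric μs) d (suc N) k ⟩
  wordSeries (cylindric μs) d (suc N) k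
    ≡⟨ ∑-marked-factorisations-words μs d ℓ≥1 μs≥1 N k ⟨
  ∑[ i < suc (suc N) ] ∑[ p < i ] ∑[ c ∈ words d (suc N) ] 𝟙 (factorsAt μs (rotate (suc N ∸ p) c) i) * 𝟙 (bigtiles c ≡ᵇ k)
    ≡⟨ xD-Bser⊛linearSeries μs d ℓ≥1 (suc N) k ⟨
  (xD (Bser μs d) ⊛ linearSeries μs d) (suc N) k
    ≡⟨ ⊛-congʳ (xD (Bser μs d)) (geomS≡linearSeries μs d ℓ≥1) (suc N) k ⟨
  (xD (Bser μs d) ⊛ geomS (Bser μs d)) (suc N) k
    ∎
  where open ≡-Reasoning
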